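{- Let $k\ge 3$, let $x_1,\dots,x_k$ be variables, let $C=(\ell_1\vee\cdots\vee\ell_k)$ where each $\ell_i\in\{x_i,\overline{x_i}\}$, and let $\alpha_{\mathrm{start}},\alpha_{\mathrm{end}}\colon\{x_1,\dots,x_k\}\to\{0,1\}$ both satisfy $C$. Let $\tilde\alpha$ be a uniformly random assignment to $\{x_1,\dots,x_k\}$, and let $\mathscr A$ be chosen uniformly at random from $\mathbb A(\alpha_{\mathrm{start}}\leftrightsquigarrow\tilde\alpha\leftrightsquigarrow\alpha_{\mathrm{end}})$. Then $$\Pr\bigl[\forall\alpha\in\mathscr A:\ \alpha\text{ satisfies }C\bigr]\ge 1-\frac{1}{k-1}-\frac1k.$$
   Context: A reconfiguration sequence $(\alpha^{(1)},\dots,\alpha^{(T)})$ from $\alpha_1$ to $\alpha_2$ is a sequence of assignments from $\alpha_1$ to $\alpha_2$ with consecutive members differing in at most one variable; it is irredundant if no two adjacent assignments are identical and for each variable $x$ there is $t^*$ with $\alpha^{(t)}(x)=\alpha_1(x)$ for $t\le t^*$ and $\alpha^{(t)}(x)=\alpha_2(x)$ for $t>t^*$ (each variable is flipped at most once). $\mathbb A(\alpha_1\leftrightsquigarrow\alpha_2)$ is the set of all irredundant reconfiguration sequences from $\alpha_1$ to $\alpha_2$, and $\mathbb A(\alpha_1\leftrightsquigarrow\alpha_2\leftrightsquigarrow\alpha_3)$ is the set of concatenations $\mathscr A\circ\mathscr A'$ with $\mathscr A\in\mathbb A(\alpha_1\leftrightsquigarrow\alpha_2)$, $\mathscr A'\in\mathbb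 A(\alpha_2\leftrightsquigarrow\alpha_3)$. -}

module Defs where

open import Data.Bool using (Bool; true; false; _∧_; _∨_; not; if_then_else_)
open import Data.Nat using (ℕ; zero; suc; _+_; _∸_; _^_; _≤ᵇ_)
open import Data.Vec using (Vec; []; _∷_; lookup)
open import Data.Fin using (Fin)
open import Data.Product using (_×_; _,_)
open import Data.List using (List; []; _∷_; length; map; concatMap; allFin; upTo; foldr; zip; _++_)
open import Data.Bool.ListAction using (all; any)
open import Data.Integer using (+_)
open import Data.Rational using (ℚ; _/_; 0ℚ)
  renaming (_+_ to _+ℚ_; _*_ to _*ℚ_)

_==_ : Bool → Bool → Bool
true  == b = b
false == b = not b

-- An assignment to the variables x_1..x_k: the i-th entry is the value of x_(i+1).
Assignment : ℕ → Set
Assignment k = Vec Bool k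

eqA : ∀ {k} → Assignment k → Assignment k → Bool
eqA {k} a b = all (λ i → lookup a i == lookup b i) (allFin k)

hamming : ∀ {k} → Assignment k → Assignment k → ℕ
hamming {k} a b = foldr (λ i n → if lookup a i == lookup b i then n else suc n) 0 (allFin k)

allAssignments : (k : ℕ) → List (Assignment k)
allAssignments zero    = [] ∷ []
allAssignments (suc k) = concatMap (λ v → (true ∷ v) ∷ (false ∷ v) ∷ []) (allAssignments k)

-- A clause (ℓ_1 ∨ ... ∨ ℓ_k) with ℓ_i ∈ {x_i, ¬x_i}:
-- sign i = true means ℓ_i = x_i, sign i = false means ℓ_i = ¬x_i.
Clause : ℕ → Set
Clause k = Vec Bool k

satisfies : ∀ {k} → Assignment k → Clause k → Bool
satisfies {k} α C = any (λ i → lookup α i == lookup C i) (allFin k)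

startsWith : ∀ {k} → Assignment k → List (Assignment k) → Bool
startsWith α1 []      = false
startsWith α1 (a ∷ s) = eqA a α1

endsWith : ∀ {k} → Assignment k → List (Assignment k) → Bool
endsWith α2 []           = false
endsWith α2 (a ∷ [])     = eqA a α2
endsWith α2 (a ∷ b ∷ s)  = endsWith α2 (b ∷ s)

consecutiveClose : ∀ {k} → List (Assignment k) → Bool
consecutiveClose []          = true
consecutiveClose (a ∷ [])    = true
consecutiveClose (a ∷ b ∷ s) = (hamming a b ≤ᵇ 1) ∧ consecutiveClose (b ∷ s)

noAdjacentRepeat : ∀ {k} → List (Assignment k) → Bool
noAdjacentRepeat []          = true
noAdjacentRepeat (a ∷ [])    = true
noAdjacentRepeat (a ∷ b ∷ s) = not (eqA a b) ∧ noAdjacentRepeat (b ∷ s)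

indexed : ∀ {k} → List (Assignment k) → List (ℕ × Assignment k)
indexed s = zip (map suc (upTo (length s))) s

flippedAtMostOnce : ∀ {k} → Assignment k → Assignment k → List (Assignment k) → Bool
flippedAtMostOnce {k} α1 α2 s =
  all (λ i →
    any (λ tstar →
      all (λ { (t , a) → if t ≤ᵇ tstar then lookup a i == lookup α1 i
                                       else lookup a i == lookup α2 i })
          (indexed s))
      (map suc (upTo (length s))))
    (allFin k)

isReconfSeq : ∀ {k} → Assignment k → Assignment k → List (Assignment k) → Bool
isReconfSeq α1 α2 s = startsWith α1 s ∧ endsWith α2 s ∧ consecutiveClose s

isIrredundant : ∀ {k} → Assignment k → Assignment k → List (Assignment k) → Bool
isIrredundant α1 α2 s =
  isReconfSeq α1 α2 s ∧ noAdjacentRepeat s ∧ flippedAtMostOnce α1 α2 s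

listsOfLength : ∀ {k} → ℕ → List (List (Assignment k))
listsOfLength {k} zero    = [] ∷ []
listsOfLength {k} (suc n) =
  concatMap (λ a → map (a ∷_) (listsOfLength n)) (allAssignments k)

-- An irredundant sequence flips each of the k variables at most once and
-- changes exactly one variable per step, so it has length T ≤ k + 1.
-- Candidates: all lists of length 1 .. k+1.
candidates : (k : ℕ) → List (List (Assignment k))
candidates k = concatMap (λ n → listsOfLength (suc n)) (upTo (suc k))

filterᵇ : {A : Set} → (A → Bool) → List A → List A
filterᵇ p []      = []
filterᵇ p (x ∷ xs) = if p x then x ∷ filterᵇ p xs else filterᵇ p xs

𝔸 : ∀ {k} → Assignment k → Assignment k → List (List (Assignment k))
𝔸 {k} α1 α2 = filterᵇ (isIrredundant α1 α2) (candidates k)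

𝔸₃ : ∀ {k} → Assignment k → Assignment k → Assignment k → List (List (Assignment k))
𝔸₃ α1 α2 α3 = concatMap (λ A → map (λ A' → A ++ A') (𝔸 α2 α3)) (𝔸 α1 α2)

count : {A : Set} → (A → Bool) → List A → ℕ
count p xs = length (filterᵇ p xs)

-- n / d as a rational (with the convention n / 0 = 0; only used with d ≠ 0)
frac : ℕ → ℕ → ℚ
frac n zero    = 0ℚ
frac n (suc d) = (+ n) / suc d

sumℚ : List ℚ → ℚ
sumℚ = foldr _+ℚ_ 0ℚ

allSatisfy : ∀ {k} → Clause k → List (Assignment k) → Bool
allSatisfy C 𝒜 = all (λ α → satisfies α C) 𝒜

-- Pr[ ∀ α ∈ 𝒜 : α satisfies C ], where α̃ is uniform over all 2^k
-- assignments and, given α̃, 𝒜 is uniform over 𝔸(αs ⇝ α̃ ⇝ αe).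
Pr : (k : ℕ) → Clause k → Assignment k → Assignment k → ℚ
Pr k C αs αe =
  frac 1 (2 ^ k) *ℚ
  sumℚ (map (λ α̃ → frac (count (allSatisfy C) (𝔸₃ αs α̃ αe)) (length (𝔸₃ αs α̃ αe)))
            (allAssignments k))

-- Let z be the assignment falsifying C. An irredundant sequence from a to b flips the
-- hamming a b variables on which a and b differ, each once and in some order, so there are
-- (hamming a b)! of them; if z lies between a and b, (hamming a z)! (hamming z b)! of them
-- pass through z. For a midpoint t let x and y be the fractions of 𝔸(s ⇝ t) and 𝔸(t ⇝ e)
-- passing through z; the two halves are chosen independently, so the good fraction is
-- (1 - x)(1 - y) ≥ 1 - x - y. With d = hamming s z ≥ 1, the average of x over t is
-- 2^-k Σ_m C(k - d, m) d! m! / (d + m)!, and for d < k each term is at most C(k, d + m) / k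
-- (for d = k the sum is 1); so the average is at most 1/k, and likewise for y. Hence the
-- probability is at least 1 - 2/k ≥ 1 - 1/(k - 1) - 1/k.

module Submission where

open import Defs

module FlipPaths where

  open import Data.Bool using (Bool; true; false; not; _∧_; _∨_; if_then_else_; T)
  open import Data.Bool.ListAction using (all; any)
  open import Data.Bool.Properties using (T-≡; not-¬; ∧-assoc; ∨-comm; ∧-zeroʳ; ∧-identityʳ; if-float)
  open import Data.Fin using (Fin; zero; suc)
  open import Data.Fin.Properties using (_≟_)
  open import Data.List as List using (List; []; _∷_; _++_; map; foldr; concatMap; allFin; length; upTo; applyUpTo; zip; filter)
  open import Data.List.Membership.Propositional using (_∈_; lose)
  open import Data.List.Membership.Propositional.Properties
    using (∈-concatMap⁺; ∈-concatMap⁻; ∈-map⁺; ∈-map⁻; ∈-allFin; ∈-upTo⁺; ∈-filter⁺; ∈-filter⁻)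
  open import Data.List.Membership.Propositional.Properties.WithK using (unique∧set⇒bag)
  open import Data.List.Properties using (map-tabulate; foldr-map; map-cong; map-applyUpTo; ∷-injectiveˡ; ∷-injectiveʳ; length-++; length-map)
  open import Data.List.Relation.Binary.BagAndSetEquality using (∼bag⇒↭)
  open import Data.List.Relation.Binary.Permutation.Propositional using (_↭_)
  open import Data.List.Relation.Binary.Permutation.Propositional.Properties using (↭-length; filter-↭)
  import Data.List.Relation.Unary.All as All
  import Data.List.Relation.Unary.All.Properties as All
  open import Data.List.Relation.Unary.AllPairs using ([]; _∷_)
  import Data.List.Relation.Unary.AllPairs as AllPairs
  import Data.List.Relation.Unary.AllPairs.Properties as AllPairs
  open import Data.List.Relation.Unary.Any using (here; there; satisfied)
  open import Data.List.Relation.Unary.Unique.Propositional using (Unique)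
  import Data.List.Relation.Unary.Unique.Propositional.Properties as Unique
  open import Data.Nat using (ℕ; zero; suc; _+_; _*_; _^_; _!; _∸_; _≤_; _<_; _≤ᵇ_; z≤n; s≤s)
  open import Data.Nat.ListAction using (sum)
  open import Data.Nat.Properties
    using (≤ᵇ⇒≤; ≤-trans; n≤1+n; n≤0⇒n≡0; ≤-pred; 0∸n≡0; +-identityʳ; +-suc; suc-injective; *-comm; *-assoc; *-zeroʳ;
           +-commutativeSemigroup)
  open import Algebra.Properties.CommutativeSemigroup +-commutativeSemigroup using (interchange)
  open import Data.Product using (_×_; _,_; ∃; proj₂)
  open import Data.Unit using (tt)
  open import Data.Vec as Vec using ([]; _∷_; lookup; head; tail; updateAt)
  open import Data.Vec.Properties using (lookup∘updateAt; lookup∘updateAt′)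
  open import Function using (id; _∘_; mk⇔; Equivalence)
  open import Relation.Binary.PropositionalEquality
  open import Relation.Nullary using (yes; no; contradiction)
  open import Relation.Nullary.Decidable using (T?)

  ==-refl : ∀ x → (x == x) ≡ true
  ==-refl true  = refl
  ==-refl false = refl

  ==-sym : ∀ x y → (x == y) ≡ (y == x)
  ==-sym true  true  = refl
  ==-sym true  false = refl
  ==-sym false true  = refl
  ==-sym false false = refl

  ==⇒≡ : ∀ {x y} → (x == y) ≡ true → x ≡ y
  ==⇒≡ {true}  {true}  _ = refl
  ==⇒≡ {false} {false} _ = refl

  ==-false⇒≡not : ∀ {x y} → (x == y) ≡ false → y ≡ not x
  ==-false⇒≡not {true}  {false} _ = refl
  ==-false⇒≡not {false} {true}  _ = refl

  ==-not : ∀ x → (x == not x) ≡ false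
  ==-not true  = refl
  ==-not false = refl

  ∧-true⁻ : ∀ x {y} → x ∧ y ≡ true → x ≡ true × y ≡ true
  ∧-true⁻ true {true} _ = refl , refl

  map-allFin-suc : ∀ {A : Set} n (f : Fin (suc n) → A) →
    map f (allFin (suc n)) ≡ f zero ∷ map (f ∘ suc) (allFin n)
  map-allFin-suc n f = cong (f zero ∷_) (trans (map-tabulate suc f) (sym (map-tabulate id (f ∘ suc))))

  foldr-allFin-suc : ∀ {B : Set} n (g : Fin (suc n) → B → B) e →
    foldr g e (allFin (suc n)) ≡ g zero (foldr (g ∘ suc) e (allFin n))
  foldr-allFin-suc n g e =
    cong (g zero) (trans (cong (foldr g e) (sym (map-tabulate id suc))) (foldr-map g suc e (allFin n)))

  all-allFin-suc : ∀ n (p : Fin (suc n) → Bool) →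
    all p (allFin (suc n)) ≡ p zero ∧ all (p ∘ suc) (allFin n)
  all-allFin-suc n p = cong (foldr _∧_ true) (map-allFin-suc n p)

  any-allFin-suc : ∀ n (p : Fin (suc n) → Bool) →
    any p (allFin (suc n)) ≡ p zero ∨ any (p ∘ suc) (allFin n)
  any-allFin-suc n p = cong (foldr _∨_ false) (map-allFin-suc n p)

  all-allFin⁻ : ∀ n (p : Fin n → Bool) → all p (allFin n) ≡ true → ∀ j → p j ≡ true
  all-allFin⁻ (suc n) p h j with ∧-true⁻ (p zero) (trans (sym (all-allFin-suc n p)) h) | j
  ... | p0 , _  | zero  = p0
  ... | _  , ps | suc j = all-allFin⁻ n (p ∘ suc) ps j

  all-allFin⁺ : ∀ n (p : Fin n → Bool) → (∀ j → p j ≡ true) → all p (allFin n) ≡ true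
  all-allFin⁺ zero    p h = refl
  all-allFin⁺ (suc n) p h =
    trans (all-allFin-suc n p) (cong₂ _∧_ (h zero) (all-allFin⁺ n (p ∘ suc) (h ∘ suc)))

  eqA-∷ : ∀ {k} x y (a b : Assignment k) → eqA (x ∷ a) (y ∷ b) ≡ (x == y) ∧ eqA a b
  eqA-∷ {k} x y a b = all-allFin-suc k (λ i → lookup (x ∷ a) i == lookup (y ∷ b) i)

  hamming-∷ : ∀ {k} x y (a b : Assignment k) →
    hamming (x ∷ a) (y ∷ b) ≡ (if x == y then hamming a b else suc (hamming a b))
  hamming-∷ {k} x y a b =
    foldr-allFin-suc k (λ i n → if lookup (x ∷ a) i == lookup (y ∷ b) i then n else suc n) 0

  satisfies-∷ : ∀ {k} x c (a : Assignment k) (C : Clause k) →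
    satisfies (x ∷ a) (c ∷ C) ≡ (x == c) ∨ satisfies a C
  satisfies-∷ {k} x c a C = any-allFin-suc k (λ i → lookup (x ∷ a) i == lookup (c ∷ C) i)

  eqA⇒≡ : ∀ {k} {a b : Assignment k} → eqA a b ≡ true → a ≡ b
  eqA⇒≡ {a = []}    {[]}    _ = refl
  eqA⇒≡ {a = x ∷ a} {y ∷ b} h with ∧-true⁻ (x == y) (trans (sym (eqA-∷ x y a b)) h)
  ... | x==y , a=b = cong₂ _∷_ (==⇒≡ x==y) (eqA⇒≡ a=b)

  eqA-refl : ∀ {k} (a : Assignment k) → eqA a a ≡ true
  eqA-refl []      = refl
  eqA-refl (x ∷ a) = trans (eqA-∷ x x a a) (cong₂ _∧_ (==-refl x) (eqA-refl a))

  ≡⇒eqA : ∀ {k} {a b : Assignment k} → a ≡ b → eqA a b ≡ true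
  ≡⇒eqA {a = a} refl = eqA-refl a

  eqA-false⇒≢ : ∀ {k} {a b : Assignment k} → eqA a b ≡ false → a ≢ b
  eqA-false⇒≢ e a≡b with () ← trans (sym e) (≡⇒eqA a≡b)

  ≢⇒eqA-false : ∀ {k} {a b : Assignment k} → a ≢ b → eqA a b ≡ false
  ≢⇒eqA-false {a = a} {b} a≢b with eqA a b in e
  ... | true  = contradiction (eqA⇒≡ e) a≢b
  ... | false = refl

  flipAt : ∀ {k} → Assignment k → Fin k → Assignment k
  flipAt a i = updateAt a i not

  lookup-flipAt : ∀ {k} (a : Assignment k) i → lookup (flipAt a i) i ≡ not (lookup a i)
  lookup-flipAt a i = lookup∘updateAt i a

  lookup-flipAt′ : ∀ {k} (a : Assignment k) {i j} → j ≢ i → lookup (flipAt a i) j ≡ lookup a j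
  lookup-flipAt′ a {i} {j} j≢i = lookup∘updateAt′ j i j≢i a

  flipAt-injective : ∀ {k} (a : Assignment k) {i j} → flipAt a i ≡ flipAt a j → i ≡ j
  flipAt-injective (x ∷ a) {zero}  {zero}  _ = refl
  flipAt-injective (x ∷ a) {zero}  {suc j} e = contradiction (sym (cong head e)) (not-¬ refl)
  flipAt-injective (x ∷ a) {suc i} {zero}  e = contradiction (cong head e) (not-¬ refl)
  flipAt-injective (x ∷ a) {suc i} {suc j} e = cong suc (flipAt-injective a (cong tail e))

  flipAt-≢ : ∀ {k} (a : Assignment k) i → a ≢ flipAt a i
  flipAt-≢ a i a≡flip = not-¬ refl (trans (cong (λ v → lookup v i) a≡flip) (lookup-flipAt a i))

  hamming-refl : ∀ {k} (a : Assignment k) → hamming a a ≡ 0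
  hamming-refl []      = refl
  hamming-refl (x ∷ a) rewrite hamming-∷ x x a a | ==-refl x = hamming-refl a

  hamming-sym : ∀ {k} (a b : Assignment k) → hamming a b ≡ hamming b a
  hamming-sym []      []      = refl
  hamming-sym (x ∷ a) (y ∷ b)
    rewrite hamming-∷ x y a b | hamming-∷ y x b a | ==-sym x y | hamming-sym a b = refl

  hamming≡0⇒≡ : ∀ {k} {a b : Assignment k} → hamming a b ≡ 0 → a ≡ b
  hamming≡0⇒≡ {a = []}    {[]}    _ = refl
  hamming≡0⇒≡ {a = x ∷ a} {y ∷ b} h rewrite hamming-∷ x y a b with x == y in x==y
  ... | true = cong₂ _∷_ (==⇒≡ x==y) (hamming≡0⇒≡ h)

  hamming≤ : ∀ {k} (a b : Assignment k) → hamming a b ≤ k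
  hamming≤ []      []      = z≤n
  hamming≤ (x ∷ a) (y ∷ b) rewrite hamming-∷ x y a b with x == y
  ... | true  = ≤-trans (hamming≤ a b) (n≤1+n _)
  ... | false = s≤s (hamming≤ a b)

  hamming-flipAt : ∀ {k} (a b : Assignment k) i → (lookup a i == lookup b i) ≡ false →
    hamming a b ≡ suc (hamming (flipAt a i) b)
  hamming-flipAt (true ∷ a)  (false ∷ b) zero _
    rewrite hamming-∷ true false a b | hamming-∷ false false a b = refl
  hamming-flipAt (false ∷ a) (true ∷ b)  zero _
    rewrite hamming-∷ false true a b | hamming-∷ true true a b = refl
  hamming-flipAt (x ∷ a) (y ∷ b) (suc i) aᵢ≠bᵢ
    rewrite hamming-∷ x y a b | hamming-∷ x y (flipAt a i) b | hamming-flipAt a b i aᵢ≠bᵢ with x == y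
  ... | true  = refl
  ... | false = refl

  hamming-flipAt-self : ∀ {k} (a : Assignment k) i → hamming a (flipAt a i) ≡ 1
  hamming-flipAt-self a i = begin
    hamming a (flipAt a i)                     ≡⟨ hamming-flipAt a (flipAt a i) i aᵢ≠flipᵢ ⟩
    suc (hamming (flipAt a i) (flipAt a i))    ≡⟨ cong suc (hamming-refl (flipAt a i)) ⟩
    1                                          ∎
    where
    open ≡-Reasoning
    aᵢ≠flipᵢ : (lookup a i == lookup (flipAt a i) i) ≡ false
    aᵢ≠flipᵢ = trans (cong (lookup a i ==_) (lookup-flipAt a i)) (==-not (lookup a i))

  hamming≤1⇒flipAt : ∀ {k} {a c : Assignment k} → hamming a c ≤ 1 → a ≢ c → ∃ λ i → c ≡ flipAt a i
  hamming≤1⇒flipAt {a = []} {[]} _ a≢c = contradiction refl a≢c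
  hamming≤1⇒flipAt {a = x ∷ a} {y ∷ c} h a≢c rewrite hamming-∷ x y a c with x == y in x==y
  ... | true with hamming≤1⇒flipAt h (λ a≡c → a≢c (cong₂ _∷_ (==⇒≡ x==y) a≡c))
  ...   | i , c≡ = suc i , cong₂ _∷_ (sym (==⇒≡ x==y)) c≡
  hamming≤1⇒flipAt {a = x ∷ a} {y ∷ c} h a≢c | false =
    zero , cong₂ _∷_ (==-false⇒≡not x==y) (sym (hamming≡0⇒≡ (n≤0⇒n≡0 (≤-pred h))))

  all-cong : ∀ {A : Set} {p q : A → Bool} → (∀ x → p x ≡ q x) → ∀ xs → all p xs ≡ all q xs
  all-cong p≗q xs = cong (foldr _∧_ true) (map-cong p≗q xs)

  any-cong : ∀ {A : Set} {p q : A → Bool} → (∀ x → p x ≡ q x) → ∀ xs → any p xs ≡ any q xs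
  any-cong p≗q xs = cong (foldr _∨_ false) (map-cong p≗q xs)

  any-applyUpTo⁻ : ∀ (p : ℕ → Bool) f n → any p (applyUpTo f n) ≡ true → ∃ λ i → i < n × p (f i) ≡ true
  any-applyUpTo⁻ p f (suc n) h with p (f 0) in p₀
  ... | true  = 0 , s≤s z≤n , p₀
  ... | false with any-applyUpTo⁻ p (f ∘ suc) n h
  ...   | i , i<n , pᵢ = suc i , s≤s i<n , pᵢ

  any-applyUpTo⁺ : ∀ (p : ℕ → Bool) f n i → i < n → p (f i) ≡ true → any p (applyUpTo f n) ≡ true
  any-applyUpTo⁺ p f (suc n) zero    _         pᵢ rewrite pᵢ = refl
  any-applyUpTo⁺ p f (suc n) (suc i) (s≤s i<n) pᵢ with p (f 0)
  ... | true  = refl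
  ... | false = any-applyUpTo⁺ p (f ∘ suc) n i i<n pᵢ

  enumerateFrom : ∀ {A : Set} → ℕ → List A → List (ℕ × A)
  enumerateFrom m []       = []
  enumerateFrom m (x ∷ xs) = (m , x) ∷ enumerateFrom (suc m) xs

  zip-applyUpTo : ∀ {A : Set} (f : ℕ → ℕ) m (xs : List A) → (∀ i → f i ≡ m + i) →
    zip (applyUpTo f (length xs)) xs ≡ enumerateFrom m xs
  zip-applyUpTo f m []       _ = refl
  zip-applyUpTo f m (x ∷ xs) f≗m+ =
    cong₂ _∷_ (cong (_, x) (trans (f≗m+ 0) (+-identityʳ m)))
              (zip-applyUpTo (f ∘ suc) (suc m) xs (λ i → trans (f≗m+ (suc i)) (+-suc m i)))

  indexed≡enumerateFrom1 : ∀ {k} (s : List (Assignment k)) → indexed s ≡ enumerateFrom 1 s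
  indexed≡enumerateFrom1 s =
    trans (cong (λ ts → zip ts s) (map-applyUpTo id suc (length s))) (zip-applyUpTo suc 1 s (λ _ → refl))

  switchesAfter : ∀ {k} → Fin k → Bool → Bool → ℕ → List (Assignment k) → Bool
  switchesAfter j x y u       []      = true
  switchesAfter j x y zero    (v ∷ s) = (lookup v j == y) ∧ switchesAfter j x y zero s
  switchesAfter j x y (suc u) (v ∷ s) = (lookup v j == x) ∧ switchesAfter j x y u s

  phase : ∀ {k} → Fin k → Bool → Bool → ℕ → ℕ × Assignment k → Bool
  phase j x y t* (t , v) = if t ≤ᵇ t* then lookup v j == x else lookup v j == y

  all-phase-enumerateFrom : ∀ {k} j x y t* m (s : List (Assignment k)) →
    all (phase j x y t*) (enumerateFrom (suc m) s) ≡ switchesAfter j x y (t* ∸ m) s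
  all-phase-enumerateFrom j x y t* m []      = refl
  all-phase-enumerateFrom j x y t* m (v ∷ s) =
    trans (cong (phase j x y t* (suc m , v) ∧_) (all-phase-enumerateFrom j x y t* (suc m) s)) (step t* m)
    where
    step : ∀ t* m → phase j x y t* (suc m , v) ∧ switchesAfter j x y (t* ∸ suc m) s
                  ≡ switchesAfter j x y (t* ∸ m) (v ∷ s)
    step zero    m rewrite 0∸n≡0 m = refl
    step (suc t) zero    = refl
    step (suc t) (suc m) = step t m

  flippedAtMostOnce-switchesAfter : ∀ {k} (a b : Assignment k) s →
    flippedAtMostOnce a b s ≡
    all (λ j → any (λ t* → switchesAfter j (lookup a j) (lookup b j) t* s) (applyUpTo suc (length s))) (allFin k)
  flippedAtMostOnce-switchesAfter {k} a b s = all-cong column (allFin k)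
    where
    column : ∀ j →
      any (λ t* → all (phase j (lookup a j) (lookup b j) t*) (indexed s)) (map suc (upTo (length s))) ≡
      any (λ t* → switchesAfter j (lookup a j) (lookup b j) t* s) (applyUpTo suc (length s))
    column j = trans (cong (any _) (map-applyUpTo id suc (length s)))
      (any-cong (λ t* → trans (cong (all _) (indexed≡enumerateFrom1 s))
                              (all-phase-enumerateFrom j (lookup a j) (lookup b j) t* 0 s))
                (applyUpTo suc (length s)))

  -- suc u is the switch time t* of variable j.
  SwitchTimes : ∀ {k} → Assignment k → Assignment k → List (Assignment k) → Set
  SwitchTimes a b s = ∀ j → ∃ λ u → u < length s × switchesAfter j (lookup a j) (lookup b j) (suc u) s ≡ true

  flippedAtMostOnce⇒SwitchTimes : ∀ {k} {a b : Assignment k} {s} →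
    flippedAtMostOnce a b s ≡ true → SwitchTimes a b s
  flippedAtMostOnce⇒SwitchTimes {k} {a} {b} {s} h j =
    any-applyUpTo⁻ _ suc (length s)
      (all-allFin⁻ k _ (trans (sym (flippedAtMostOnce-switchesAfter a b s)) h) j)

  SwitchTimes⇒flippedAtMostOnce : ∀ {k} {a b : Assignment k} {s} →
    SwitchTimes a b s → flippedAtMostOnce a b s ≡ true
  SwitchTimes⇒flippedAtMostOnce {k} {a} {b} {s} h =
    trans (flippedAtMostOnce-switchesAfter a b s) (all-allFin⁺ k _ column)
    where
    column : ∀ j → any (λ t* → switchesAfter j (lookup a j) (lookup b j) t* s) (applyUpTo suc (length s)) ≡ true
    column j with h j
    ... | u , u<len , sw = any-applyUpTo⁺ _ suc (length s) u u<len sw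

  switchesAfter-zero : ∀ {k} j x x′ y (s : List (Assignment k)) →
    switchesAfter j x y 0 s ≡ switchesAfter j x′ y 0 s
  switchesAfter-zero j x x′ y []      = refl
  switchesAfter-zero j x x′ y (v ∷ s) = cong ((lookup v j == y) ∧_) (switchesAfter-zero j x x′ y s)

  switchesAfter-const : ∀ {k} j x y u (s : List (Assignment k)) →
    switchesAfter j y y u s ≡ true → switchesAfter j x y 0 s ≡ true
  switchesAfter-const j x y u       []      _ = refl
  switchesAfter-const j x y zero    (v ∷ s) h = trans (switchesAfter-zero j x y y (v ∷ s)) h
  switchesAfter-const j x y (suc u) (v ∷ s) h with ∧-true⁻ (lookup v j == y) h
  ... | vⱼ≡y , rest = cong₂ _∧_ vⱼ≡y (switchesAfter-const j x y u s rest)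

  -- The irredundant reconfiguration sequences from a to b, inductively.
  data FlipPath {k} : Assignment k → Assignment k → List (Assignment k) → Set where
    done : ∀ {b} → FlipPath b b (b ∷ [])
    step : ∀ {a b s} i → (lookup a i == lookup b i) ≡ false → FlipPath (flipAt a i) b s → FlipPath a b (a ∷ s)

  FlipPath-length : ∀ {k} {a b : Assignment k} {s} → FlipPath a b s → length s ≡ suc (hamming a b)
  FlipPath-length (done {b})            = cong suc (sym (hamming-refl b))
  FlipPath-length (step {a} {b} i aᵢ≠bᵢ p) = cong suc (trans (FlipPath-length p) (sym (hamming-flipAt a b i aᵢ≠bᵢ)))

  FlipPath⇒SwitchTimes : ∀ {k} {a b : Assignment k} {s} → FlipPath a b s → SwitchTimes a b s
  FlipPath⇒SwitchTimes (done {b}) j = 0 , s≤s z≤n , cong (_∧ true) (==-refl (lookup b j))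
  FlipPath⇒SwitchTimes (step {a} {b} {s} i aᵢ≠bᵢ p) j with i ≟ j | FlipPath⇒SwitchTimes p j
  ... | yes refl | u , _ , sw =
    0 , s≤s z≤n , cong₂ _∧_ (==-refl (lookup a i)) (switchesAfter-const i (lookup a i) (lookup b i) (suc u) s sw′)
    where
    flipᵢ≡bᵢ : lookup (flipAt a i) i ≡ lookup b i
    flipᵢ≡bᵢ = trans (lookup-flipAt a i) (sym (==-false⇒≡not aᵢ≠bᵢ))
    sw′ : switchesAfter i (lookup b i) (lookup b i) (suc u) s ≡ true
    sw′ = subst (λ x → switchesAfter i x (lookup b i) (suc u) s ≡ true) flipᵢ≡bᵢ sw
  ... | no i≢j   | u , u<len , sw = suc u , s≤s u<len , cong₂ _∧_ (==-refl (lookup a j)) sw′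
    where
    sw′ : switchesAfter j (lookup a j) (lookup b j) (suc u) s ≡ true
    sw′ = subst (λ x → switchesAfter j x (lookup b j) (suc u) s ≡ true) (lookup-flipAt′ a (i≢j ∘ sym)) sw

  FlipPath-startsWith : ∀ {k} {a b : Assignment k} {s} → FlipPath a b s → startsWith a s ≡ true
  FlipPath-startsWith (done {b})     = eqA-refl b
  FlipPath-startsWith (step {a} _ _ _) = eqA-refl a

  FlipPath-endsWith : ∀ {k} {a b : Assignment k} {s} → FlipPath a b s → endsWith b s ≡ true
  FlipPath-endsWith (done {b})          = eqA-refl b
  FlipPath-endsWith (step {b = b} _ _ done) = eqA-refl b
  FlipPath-endsWith (step _ _ (step i d p))  = FlipPath-endsWith (step i d p)

  FlipPath-consecutiveClose : ∀ {k} {a b : Assignment k} {s} → FlipPath a b s → consecutiveClose s ≡ true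
  FlipPath-consecutiveClose done = refl
  FlipPath-consecutiveClose (step {a} i _ done) rewrite hamming-flipAt-self a i = refl
  FlipPath-consecutiveClose (step {a} i _ (step i′ d p)) =
    cong₂ _∧_ (cong (_≤ᵇ 1) (hamming-flipAt-self a i)) (FlipPath-consecutiveClose (step i′ d p))

  FlipPath-noAdjacentRepeat : ∀ {k} {a b : Assignment k} {s} → FlipPath a b s → noAdjacentRepeat s ≡ true
  FlipPath-noAdjacentRepeat done = refl
  FlipPath-noAdjacentRepeat (step {a} i _ done) rewrite ≢⇒eqA-false (flipAt-≢ a i) = refl
  FlipPath-noAdjacentRepeat (step {a} i _ (step i′ d p)) =
    cong₂ _∧_ (cong not (≢⇒eqA-false (flipAt-≢ a i))) (FlipPath-noAdjacentRepeat (step i′ d p))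

  FlipPath⇒isIrredundant : ∀ {k} {a b : Assignment k} {s} → FlipPath a b s → isIrredundant a b s ≡ true
  FlipPath⇒isIrredundant {a = a} {b} {s} p =
    cong₂ _∧_ (cong₂ _∧_ (FlipPath-startsWith p) (cong₂ _∧_ (FlipPath-endsWith p) (FlipPath-consecutiveClose p)))
              (cong₂ _∧_ (FlipPath-noAdjacentRepeat p) (SwitchTimes⇒flippedAtMostOnce {a = a} {b} {s} (FlipPath⇒SwitchTimes p)))

  ≤ᵇ-true⇒≤ : ∀ {m n} → (m ≤ᵇ n) ≡ true → m ≤ n
  ≤ᵇ-true⇒≤ {m} {n} h = ≤ᵇ⇒≤ m n (subst T (sym h) tt)

  not-true⇒false : ∀ {x} → not x ≡ true → x ≡ false
  not-true⇒false {false} _ = refl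

  SwitchTimes-tail : ∀ {k} {a b c : Assignment k} {r} → SwitchTimes a b (a ∷ c ∷ r) → SwitchTimes c b (c ∷ r)
  SwitchTimes-tail {a = a} {b} {c} {r} h j with h j
  ... | zero , _ , sw with ∧-true⁻ (lookup a j == lookup a j) sw
  ...   | _ , sw′ with ∧-true⁻ (lookup c j == lookup b j) sw′
  ...     | cⱼ≡bⱼ , rest =
    0 , s≤s z≤n , cong₂ _∧_ (==-refl (lookup c j)) (trans (switchesAfter-zero j (lookup c j) (lookup a j) (lookup b j) r) rest)
  SwitchTimes-tail {a = a} {b} {c} {r} h j | suc u , s≤s u<len , sw with ∧-true⁻ (lookup a j == lookup a j) sw
  ...   | _ , sw′ with ∧-true⁻ (lookup c j == lookup a j) sw′
  ...     | cⱼ≡aⱼ , rest =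
    u , u<len , cong₂ _∧_ (==-refl (lookup c j))
                   (subst (λ x → switchesAfter j x (lookup b j) u r ≡ true) (sym (==⇒≡ cⱼ≡aⱼ)) rest)

  SwitchTimes⇒flipped-differs : ∀ {k} {a b c : Assignment k} {i r} → c ≡ flipAt a i →
    SwitchTimes a b (a ∷ c ∷ r) → (lookup a i == lookup b i) ≡ false
  SwitchTimes⇒flipped-differs {a = a} {b} {i = i} refl h with h i
  ... | zero , _ , sw with ∧-true⁻ (lookup a i == lookup a i) sw
  ...   | _ , sw′ with ∧-true⁻ (lookup (flipAt a i) i == lookup b i) sw′
  ...     | flipᵢ≡bᵢ , _ = begin
    lookup a i == lookup b i             ≡⟨ cong (lookup a i ==_) (sym (==⇒≡ flipᵢ≡bᵢ)) ⟩
    lookup a i == lookup (flipAt a i) i  ≡⟨ cong (lookup a i ==_) (lookup-flipAt a i) ⟩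
    lookup a i == not (lookup a i)       ≡⟨ ==-not (lookup a i) ⟩
    false                                ∎
    where open ≡-Reasoning
  SwitchTimes⇒flipped-differs {a = a} {b} {i = i} refl h | suc u , _ , sw with ∧-true⁻ (lookup a i == lookup a i) sw
  ...   | _ , sw′ with ∧-true⁻ (lookup (flipAt a i) i == lookup a i) sw′
  ...     | flipᵢ≡aᵢ , _ = contradiction (trans (sym (==⇒≡ flipᵢ≡aᵢ)) (lookup-flipAt a i)) (not-¬ refl)

  conditions⇒FlipPath : ∀ {k} {b : Assignment k} v s →
    endsWith b (v ∷ s) ≡ true → consecutiveClose (v ∷ s) ≡ true →
    noAdjacentRepeat (v ∷ s) ≡ true → SwitchTimes v b (v ∷ s) → FlipPath v b (v ∷ s)
  conditions⇒FlipPath {b = b} v [] en _ _ _ with eqA⇒≡ {a = v} {b} en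
  ... | refl = done
  conditions⇒FlipPath {b = b} v (c ∷ r) en cc nr sw
    with ∧-true⁻ (hamming v c ≤ᵇ 1) cc | ∧-true⁻ (not (eqA v c)) nr
  ... | close , cc′ | distinct , nr′
    with hamming≤1⇒flipAt {a = v} {c} (≤ᵇ-true⇒≤ close) (eqA-false⇒≢ (not-true⇒false distinct))
  ...   | i , c≡flip =
    step i (SwitchTimes⇒flipped-differs {b = b} {r = r} c≡flip sw)
           (subst (λ x → FlipPath x b (c ∷ r)) c≡flip
                  (conditions⇒FlipPath c r en cc′ nr′ (SwitchTimes-tail {a = v} {b} {c} {r} sw)))

  isIrredundant⇒FlipPath : ∀ {k} {a b : Assignment k} {s} → isIrredundant a b s ≡ true → FlipPath a b s
  isIrredundant⇒FlipPath {a = a} {b} {v ∷ s} h with ∧-true⁻ (isReconfSeq a b (v ∷ s)) h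
  ... | reconf , rest with ∧-true⁻ (startsWith a (v ∷ s)) reconf | ∧-true⁻ (noAdjacentRepeat (v ∷ s)) rest
  ...   | st , en∧cc | nr , fmo with ∧-true⁻ (endsWith b (v ∷ s)) en∧cc | eqA⇒≡ {a = v} {a} st
  ...     | en , cc | refl = conditions⇒FlipPath v s en cc nr (flippedAtMostOnce⇒SwitchTimes {a = v} {b} {v ∷ s} fmo)

  concatMap-unique : ∀ {A B : Set} {f : A → List B} {xs} → Unique xs → (∀ x → Unique (f x)) →
    (∀ {x y w} → w ∈ f x → w ∈ f y → x ≡ y) → Unique (concatMap f xs)
  concatMap-unique {xs = xs} u uf common⇒≡ =
    Unique.concat⁺ (All.map⁺ (All.universal uf xs))
                   (AllPairs.map⁺ (AllPairs.map (λ x≢y {w} (w∈fx , w∈fy) → x≢y (common⇒≡ w∈fx w∈fy)) u))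

  mutual
    flipPaths : ∀ {k} → ℕ → Assignment k → Assignment k → List (List (Assignment k))
    flipPaths         zero    a b = (a ∷ []) ∷ []
    flipPaths {k = k} (suc n) a b = concatMap (flipPathsVia n a b) (allFin k)

    flipPathsVia : ∀ {k} → ℕ → Assignment k → Assignment k → Fin k → List (List (Assignment k))
    flipPathsVia n a b i = if lookup a i == lookup b i then [] else map (a ∷_) (flipPaths n (flipAt a i) b)

  ∈-flipPathsVia⁻ : ∀ {k} n (a b : Assignment k) i {w} → w ∈ flipPathsVia n a b i →
    (lookup a i == lookup b i) ≡ false × ∃ λ w′ → w ≡ a ∷ w′ × w′ ∈ flipPaths n (flipAt a i) b
  ∈-flipPathsVia⁻ n a b i w∈ with lookup a i == lookup b i in aᵢ≠bᵢ
  ... | false with ∈-map⁻ (a ∷_) w∈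
  ...   | w′ , w′∈ , refl = refl , w′ , refl , w′∈

  flipPaths-sound : ∀ {k} n {a b : Assignment k} → hamming a b ≡ n → ∀ {w} → w ∈ flipPaths n a b → FlipPath a b w
  flipPaths-sound zero    {a} {b} h (here refl) with hamming≡0⇒≡ {a = a} {b} h
  ... | refl = done
  flipPaths-sound (suc n) {a} {b} h w∈ with satisfied (∈-concatMap⁻ (flipPathsVia n a b) {xs = allFin _} w∈)
  ... | i , w∈ᵢ with ∈-flipPathsVia⁻ n a b i w∈ᵢ
  ...   | aᵢ≠bᵢ , w′ , refl , w′∈ =
    step i aᵢ≠bᵢ (flipPaths-sound n (suc-injective (trans (sym (hamming-flipAt a b i aᵢ≠bᵢ)) h)) w′∈)

  flipPaths-complete : ∀ {k} {a b : Assignment k} {w} → FlipPath a b w → w ∈ flipPaths (hamming a b) a b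
  flipPaths-complete (done {b}) rewrite hamming-refl b = here refl
  flipPaths-complete (step {a} {b} {s} i aᵢ≠bᵢ p) rewrite hamming-flipAt a b i aᵢ≠bᵢ =
    ∈-concatMap⁺ (flipPathsVia (hamming (flipAt a i) b) a b) (lose (∈-allFin i) via)
    where
    via : (a ∷ s) ∈ flipPathsVia (hamming (flipAt a i) b) a b i
    via rewrite aᵢ≠bᵢ = ∈-map⁺ (a ∷_) (flipPaths-complete p)

  flipPaths-head : ∀ {k} n {a b : Assignment k} {w} → w ∈ flipPaths n a b → ∃ λ w′ → w ≡ a ∷ w′
  flipPaths-head zero    (here refl) = [] , refl
  flipPaths-head (suc n) {a} {b} w∈ with satisfied (∈-concatMap⁻ (flipPathsVia n a b) {xs = allFin _} w∈)
  ... | i , w∈ᵢ with ∈-flipPathsVia⁻ n a b i w∈ᵢ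
  ...   | _ , w′ , refl , _ = w′ , refl

  flipPaths-unique : ∀ {k} n (a b : Assignment k) → Unique (flipPaths n a b)
  flipPaths-unique         zero    a b = All.[] ∷ []
  flipPaths-unique {k = k} (suc n) a b = concatMap-unique (Unique.allFin⁺ k) via-unique first-step-≡
    where
    via-unique : ∀ i → Unique (flipPathsVia n a b i)
    via-unique i with lookup a i == lookup b i
    ... | true  = []
    ... | false = Unique.map⁺ ∷-injectiveʳ (flipPaths-unique n (flipAt a i) b)
    second : ∀ {i w} → w ∈ flipPathsVia n a b i → ∃ λ w′ → w ≡ a ∷ flipAt a i ∷ w′
    second {i} w∈ with ∈-flipPathsVia⁻ n a b i w∈
    ... | _ , _ , refl , w′∈ with flipPaths-head n w′∈
    ...   | w″ , refl = w″ , refl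
    first-step-≡ : ∀ {i j w} → w ∈ flipPathsVia n a b i → w ∈ flipPathsVia n a b j → i ≡ j
    first-step-≡ w∈ᵢ w∈ⱼ with second w∈ᵢ | second w∈ⱼ
    ... | _ , refl | _ , eq = flipAt-injective a (∷-injectiveˡ (∷-injectiveʳ eq))

  length-concatMap : ∀ {A B : Set} (f : A → List B) xs → length (concatMap f xs) ≡ sum (map (length ∘ f) xs)
  length-concatMap f []       = refl
  length-concatMap f (x ∷ xs) = trans (length-++ (f x)) (cong (length (f x) +_) (length-concatMap f xs))

  sum-differing : ∀ {k} (a b : Assignment k) (g : Fin k → ℕ) c → (∀ i → (lookup a i == lookup b i) ≡ false → g i ≡ c) →
    sum (map (λ i → if lookup a i == lookup b i then 0 else g i) (allFin k)) ≡ hamming a b * c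
  sum-differing []      []      g c _ = refl
  sum-differing {suc k} (x ∷ a) (y ∷ b) g c g≡c = begin
    sum (map F (allFin (suc k)))               ≡⟨ cong sum (map-allFin-suc k F) ⟩
    F zero + sum (map (F ∘ suc) (allFin k))    ≡⟨ cong (F zero +_) (sum-differing a b (g ∘ suc) c (g≡c ∘ suc)) ⟩
    F zero + hamming a b * c                   ≡⟨ first ⟩
    hamming (x ∷ a) (y ∷ b) * c                ∎
    where
    open ≡-Reasoning
    F : Fin (suc k) → ℕ
    F i = if lookup (x ∷ a) i == lookup (y ∷ b) i then 0 else g i
    first : F zero + hamming a b * c ≡ hamming (x ∷ a) (y ∷ b) * c
    first rewrite hamming-∷ x y a b with x == y in x==y
    ... | true  = refl
    ... | false = cong (_+ hamming a b * c) (g≡c zero x==y)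

  length-flipPaths : ∀ {k} n (a b : Assignment k) → hamming a b ≡ n → length (flipPaths n a b) ≡ n !
  length-flipPaths         zero    a b _ = refl
  length-flipPaths {k = k} (suc n) a b h = begin
    length (concatMap (flipPathsVia n a b) (allFin k))            ≡⟨ length-concatMap (flipPathsVia n a b) (allFin k) ⟩
    sum (map (length ∘ flipPathsVia n a b) (allFin k))            ≡⟨ cong sum (map-cong via (allFin k)) ⟩
    sum (map (λ i → if lookup a i == lookup b i then 0 else length (flipPaths n (flipAt a i) b)) (allFin k))
      ≡⟨ sum-differing a b _ (n !) (λ i aᵢ≠bᵢ → length-flipPaths n (flipAt a i) b
                                           (suc-injective (trans (sym (hamming-flipAt a b i aᵢ≠bᵢ)) h))) ⟩
    hamming a b * n !                                              ≡⟨ cong (_* n !) h ⟩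
    suc n !                                                        ∎
    where
    open ≡-Reasoning
    via : ∀ i → length (flipPathsVia n a b i) ≡ (if lookup a i == lookup b i then 0 else length (flipPaths n (flipAt a i) b))
    via i = trans (if-float length (lookup a i == lookup b i))
                  (cong (if lookup a i == lookup b i then 0 else_) (length-map (List._∷_ a) (flipPaths n (flipAt a i) b)))

  allAssignments-complete : ∀ {k} (a : Assignment k) → a ∈ allAssignments k
  allAssignments-complete []          = here refl
  allAssignments-complete (true ∷ a)  = ∈-concatMap⁺ _ (lose (allAssignments-complete a) (here refl))
  allAssignments-complete (false ∷ a) = ∈-concatMap⁺ _ (lose (allAssignments-complete a) (there (here refl)))

  allAssignments-unique : ∀ k → Unique (allAssignments k)
  allAssignments-unique zero    = All.[] ∷ []
  allAssignments-unique (suc k) = concatMap-unique (allAssignments-unique k) (λ _ → ((λ ()) All.∷ All.[]) ∷ All.[] ∷ []) same-tail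
    where
    tail≡ : ∀ {v w} → w ∈ (true ∷ v) List.∷ (false ∷ v) List.∷ [] → tail w ≡ v
    tail≡ (here refl)         = refl
    tail≡ (there (here refl)) = refl
    same-tail : ∀ {v v′ w} → w ∈ (true ∷ v) List.∷ (false ∷ v) List.∷ [] →
                w ∈ (true ∷ v′) List.∷ (false ∷ v′) List.∷ [] → v ≡ v′
    same-tail w∈ w∈′ = trans (sym (tail≡ w∈)) (tail≡ w∈′)

  length-allAssignments : ∀ k → length (allAssignments k) ≡ 2 ^ k
  length-allAssignments zero    = refl
  length-allAssignments (suc k) = begin
    length (allAssignments (suc k))                    ≡⟨ length-concatMap _ (allAssignments k) ⟩
    sum (map (λ _ → 2) (allAssignments k))             ≡⟨ sum-const 2 (allAssignments k) ⟩
    length (allAssignments k) * 2                      ≡⟨ cong (_* 2) (length-allAssignments k) ⟩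
    2 ^ k * 2                                          ≡⟨ *-comm (2 ^ k) 2 ⟩
    2 ^ suc k                                          ∎
    where
    open ≡-Reasoning
    sum-const : ∀ {A : Set} c (xs : List A) → sum (map (λ _ → c) xs) ≡ length xs * c
    sum-const c []       = refl
    sum-const c (x ∷ xs) = cong (c +_) (sum-const c xs)

  listsOfLength-complete : ∀ {k} (w : List (Assignment k)) → w ∈ listsOfLength (length w)
  listsOfLength-complete []      = here refl
  listsOfLength-complete (a ∷ w) =
    ∈-concatMap⁺ _ (lose (allAssignments-complete a) (∈-map⁺ (a ∷_) (listsOfLength-complete w)))

  listsOfLength-length : ∀ {k} n {w : List (Assignment k)} → w ∈ listsOfLength n → length w ≡ n
  listsOfLength-length zero    (here refl) = refl
  listsOfLength-length (suc n) w∈ with satisfied (∈-concatMap⁻ _ {xs = allAssignments _} w∈)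
  ... | a , w∈ₐ with ∈-map⁻ (a ∷_) w∈ₐ
  ...   | w′ , w′∈ , refl = cong suc (listsOfLength-length n w′∈)

  listsOfLength-unique : ∀ {k} n → Unique (listsOfLength {k} n)
  listsOfLength-unique     zero    = All.[] ∷ []
  listsOfLength-unique {k} (suc n) =
    concatMap-unique (allAssignments-unique k) (λ _ → Unique.map⁺ ∷-injectiveʳ (listsOfLength-unique n)) same-head
    where
    head≡ : ∀ {a w} → w ∈ map (a ∷_) (listsOfLength {k} n) → ∃ λ w′ → w ≡ a ∷ w′
    head≡ {a} w∈ with ∈-map⁻ (a ∷_) w∈
    ... | w′ , _ , refl = w′ , refl
    same-head : ∀ {a a′ w} → w ∈ map (a ∷_) (listsOfLength n) → w ∈ map (a′ ∷_) (listsOfLength n) → a ≡ a′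
    same-head w∈ w∈′ with head≡ w∈ | head≡ w∈′
    ... | _ , refl | _ , eq = ∷-injectiveˡ eq

  candidates-complete : ∀ {k} (w : List (Assignment k)) → 1 ≤ length w → length w ≤ suc k → w ∈ candidates k
  candidates-complete (a ∷ w) _ (s≤s len≤) =
    ∈-concatMap⁺ _ (lose (∈-upTo⁺ (s≤s len≤)) (listsOfLength-complete (a ∷ w)))

  candidates-unique : ∀ k → Unique (candidates k)
  candidates-unique k = concatMap-unique (Unique.upTo⁺ (suc k)) (λ n → listsOfLength-unique (suc n)) same-length
    where
    same-length : ∀ {n n′ w} → w ∈ listsOfLength {k} (suc n) → w ∈ listsOfLength (suc n′) → n ≡ n′
    same-length {n} {n′} w∈ w∈′ = suc-injective (trans (sym (listsOfLength-length (suc n) w∈)) (listsOfLength-length (suc n′) w∈′))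

  filterᵇ≡filter : ∀ {A : Set} (p : A → Bool) xs → filterᵇ p xs ≡ filter (T? ∘ p) xs
  filterᵇ≡filter p []       = refl
  filterᵇ≡filter p (x ∷ xs) with p x
  ... | true  = cong (x ∷_) (filterᵇ≡filter p xs)
  ... | false = filterᵇ≡filter p xs

  ∈-𝔸⁻ : ∀ {k} {a b : Assignment k} {w} → w ∈ 𝔸 a b → FlipPath a b w
  ∈-𝔸⁻ {k} {a} {b} w∈
    with ∈-filter⁻ (T? ∘ isIrredundant a b) {xs = candidates k} (subst (_ ∈_) (filterᵇ≡filter _ (candidates k)) w∈)
  ... | _ , irr = isIrredundant⇒FlipPath (Equivalence.to T-≡ irr)

  ∈-𝔸⁺ : ∀ {k} {a b : Assignment k} {w} → FlipPath a b w → w ∈ 𝔸 a b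
  ∈-𝔸⁺ {k} {a} {b} {w} p =
    subst (w ∈_) (sym (filterᵇ≡filter _ (candidates k)))
      (∈-filter⁺ (T? ∘ isIrredundant a b) w∈candidates (Equivalence.from T-≡ (FlipPath⇒isIrredundant p)))
    where
    w∈candidates : w ∈ candidates k
    w∈candidates = candidates-complete w (subst (1 ≤_) (sym (FlipPath-length p)) (s≤s z≤n))
                                         (subst (_≤ suc k) (sym (FlipPath-length p)) (s≤s (hamming≤ a b)))

  𝔸-unique : ∀ {k} (a b : Assignment k) → Unique (𝔸 a b)
  𝔸-unique {k} a b = subst Unique (sym (filterᵇ≡filter _ (candidates k))) (Unique.filter⁺ _ (candidates-unique k))

  𝔸↭flipPaths : ∀ {k} (a b : Assignment k) → 𝔸 a b ↭ flipPaths (hamming a b) a b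
  𝔸↭flipPaths a b = ∼bag⇒↭ (unique∧set⇒bag (𝔸-unique a b) (flipPaths-unique (hamming a b) a b)
                               (mk⇔ (flipPaths-complete ∘ ∈-𝔸⁻) (∈-𝔸⁺ ∘ flipPaths-sound _ refl)))

  count-++ : ∀ {A : Set} (p : A → Bool) xs ys → count p (xs ++ ys) ≡ count p xs + count p ys
  count-++ p []       ys = refl
  count-++ p (x ∷ xs) ys with p x
  ... | true  = cong suc (count-++ p xs ys)
  ... | false = count-++ p xs ys

  count-concatMap : ∀ {A B : Set} (p : B → Bool) (f : A → List B) xs →
    count p (concatMap f xs) ≡ sum (map (count p ∘ f) xs)
  count-concatMap p f []       = refl
  count-concatMap p f (x ∷ xs) = trans (count-++ p (f x) (concatMap f xs)) (cong (count p (f x) +_) (count-concatMap p f xs))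

  count-↭ : ∀ {A : Set} (p : A → Bool) {xs ys} → xs ↭ ys → count p xs ≡ count p ys
  count-↭ p {xs} {ys} xs↭ys = begin
    length (filterᵇ p xs)            ≡⟨ cong length (filterᵇ≡filter p xs) ⟩
    length (filter (T? ∘ p) xs)      ≡⟨ ↭-length (filter-↭ (T? ∘ p) xs↭ys) ⟩
    length (filter (T? ∘ p) ys)      ≡⟨ cong length (filterᵇ≡filter p ys) ⟨
    length (filterᵇ p ys)            ∎
    where open ≡-Reasoning

  count-true : ∀ {A : Set} (xs : List A) → count (λ _ → true) xs ≡ length xs
  count-true []       = refl
  count-true (x ∷ xs) = cong suc (count-true xs)

  module _ {A : Set} (p : List A → Bool) (p-++ : ∀ xs ys → p (xs ++ ys) ≡ p xs ∧ p ys) where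

    count-map-++ : ∀ xs ys → count p (map (xs ++_) ys) ≡ (if p xs then count p ys else 0)
    count-map-++ xs []        with p xs
    ... | true  = refl
    ... | false = refl
    count-map-++ xs (ys ∷ yss) rewrite p-++ xs ys with p xs | p ys | count-map-++ xs yss
    ... | true  | true  | ih = cong suc ih
    ... | true  | false | ih = ih
    ... | false | _     | ih = ih

    count-concatMap-++ : ∀ xss yss → count p (concatMap (λ xs → map (xs ++_) yss) xss) ≡ count p xss * count p yss
    count-concatMap-++ []         yss = refl
    count-concatMap-++ (xs ∷ xss) yss
      rewrite count-++ p (map (xs ++_) yss) (concatMap (λ xs → map (xs ++_) yss) xss)
            | count-map-++ xs yss | count-concatMap-++ xss yss with p xs
    ... | true  = refl
    ... | false = refl

  allSatisfy-++ : ∀ {k} (C : Clause k) xs ys → allSatisfy C (xs ++ ys) ≡ allSatisfy C xs ∧ allSatisfy C ys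
  allSatisfy-++ C []       ys = refl
  allSatisfy-++ C (x ∷ xs) ys rewrite allSatisfy-++ C xs ys = sym (∧-assoc (satisfies x C) _ _)

  length-𝔸₃ : ∀ {k} (a b c : Assignment k) → length (𝔸₃ a b c) ≡ length (𝔸 a b) * length (𝔸 b c)
  length-𝔸₃ a b c = begin
    length (𝔸₃ a b c)                                      ≡⟨ count-true (𝔸₃ a b c) ⟨
    count (λ _ → true) (𝔸₃ a b c)                          ≡⟨ count-concatMap-++ (λ _ → true) (λ _ _ → refl) (𝔸 a b) (𝔸 b c) ⟩
    count (λ _ → true) (𝔸 a b) * count (λ _ → true) (𝔸 b c) ≡⟨ cong₂ _*_ (count-true (𝔸 a b)) (count-true (𝔸 b c)) ⟩
    length (𝔸 a b) * length (𝔸 b c)                        ∎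
    where open ≡-Reasoning

  count-𝔸₃ : ∀ {k} (C : Clause k) (a b c : Assignment k) →
    count (allSatisfy C) (𝔸₃ a b c) ≡ count (allSatisfy C) (𝔸 a b) * count (allSatisfy C) (𝔸 b c)
  count-𝔸₃ C a b c = count-concatMap-++ (allSatisfy C) (allSatisfy-++ C) (𝔸 a b) (𝔸 b c)

  falsifier : ∀ {k} → Clause k → Assignment k
  falsifier = Vec.map not

  satisfies≡not-eqA-falsifier : ∀ {k} (a : Assignment k) C → satisfies a C ≡ not (eqA a (falsifier C))
  satisfies≡not-eqA-falsifier []      []      = refl
  satisfies≡not-eqA-falsifier (x ∷ a) (c ∷ C)
    rewrite satisfies-∷ x c a C | eqA-∷ x (not c) a (falsifier C) | satisfies≡not-eqA-falsifier a C with x | c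
  ... | true  | true  = refl
  ... | true  | false = refl
  ... | false | true  = refl
  ... | false | false = refl

  -- z lies on some irredundant sequence from a to b.
  inBox : ∀ {k} → Assignment k → Assignment k → Assignment k → Bool
  inBox []      []      []      = true
  inBox (x ∷ a) (y ∷ z) (w ∷ b) = ((y == x) ∨ (y == w)) ∧ inBox a z b

  inBox-self : ∀ {k} (a z : Assignment k) → inBox a z a ≡ eqA a z
  inBox-self []      []      = refl
  inBox-self (x ∷ a) (y ∷ z) rewrite eqA-∷ x y a z | inBox-self a z with x | y
  ... | true  | true  = refl
  ... | true  | false = refl
  ... | false | true  = refl
  ... | false | false = refl

  inBox-start : ∀ {k} (z b : Assignment k) → inBox z z b ≡ true
  inBox-start []      []      = refl
  inBox-start (y ∷ z) (w ∷ b) rewrite ==-refl y = inBox-start z b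

  inBox-sym : ∀ {k} (a z b : Assignment k) → inBox a z b ≡ inBox b z a
  inBox-sym []      []      []      = refl
  inBox-sym (x ∷ a) (y ∷ z) (w ∷ b) = cong₂ _∧_ (∨-comm (y == x) (y == w)) (inBox-sym a z b)

  inBox-flipAt : ∀ {k} (a z b : Assignment k) i → (lookup a i == lookup b i) ≡ false →
    inBox (flipAt a i) z b ≡ inBox a z b ∧ not (lookup a i == lookup z i)
  inBox-flipAt (x ∷ a) (y ∷ z) (w ∷ b) zero _ with x | y | w
  ... | true  | true  | false = sym (∧-zeroʳ (inBox a z b))
  ... | true  | false | false = sym (∧-identityʳ (inBox a z b))
  ... | false | true  | true  = sym (∧-identityʳ (inBox a z b))
  ... | false | false | true  = sym (∧-zeroʳ (inBox a z b))
  inBox-flipAt (x ∷ a) (y ∷ z) (w ∷ b) (suc i) aᵢ≠bᵢ =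
    trans (cong (((y == x) ∨ (y == w)) ∧_) (inBox-flipAt a z b i aᵢ≠bᵢ))
          (sym (∧-assoc ((y == x) ∨ (y == w)) (inBox a z b) _))

  inBox-differs : ∀ {k} (a z b : Assignment k) i → inBox a z b ≡ true →
    (lookup a i == lookup z i) ≡ false → (lookup a i == lookup b i) ≡ false
  inBox-differs (x ∷ a) (y ∷ z) (w ∷ b) zero    box aᵢ≠zᵢ with x | y | w
  ... | true  | false | false = refl
  ... | false | true  | true  = refl
  inBox-differs (x ∷ a) (y ∷ z) (w ∷ b) (suc i) box aᵢ≠zᵢ =
    inBox-differs a z b i (proj₂ (∧-true⁻ ((y == x) ∨ (y == w)) box)) aᵢ≠zᵢ

  hamming-inBox : ∀ {k} (a z b : Assignment k) → inBox a z b ≡ true → hamming a b ≡ hamming a z + hamming z b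
  hamming-inBox []      []      []      _ = refl
  hamming-inBox (x ∷ a) (y ∷ z) (w ∷ b) box
    rewrite hamming-∷ x w a b | hamming-∷ x y a z | hamming-∷ y w z b with x | y | w
  ... | true  | true  | true  = hamming-inBox a z b box
  ... | true  | true  | false = trans (cong suc (hamming-inBox a z b box)) (sym (+-suc (hamming a z) (hamming z b)))
  ... | true  | false | false = cong suc (hamming-inBox a z b box)
  ... | false | false | false = hamming-inBox a z b box
  ... | false | false | true  = trans (cong suc (hamming-inBox a z b box)) (sym (+-suc (hamming a z) (hamming z b)))
  ... | false | true  | true  = cong suc (hamming-inBox a z b box)

  satisfies⇒differs-falsifier : ∀ {k} (a : Assignment k) C → satisfies a C ≡ true →
    ∃ λ d → hamming a (falsifier C) ≡ suc d
  satisfies⇒differs-falsifier a C sat with hamming a (falsifier C) in h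
  ... | suc d = d , refl
  ... | zero with () ← trans (sym sat) (trans (satisfies≡not-eqA-falsifier a C) (cong not (≡⇒eqA (hamming≡0⇒≡ {a = a} {falsifier C} h))))

  -- The number of irredundant sequences from a to b passing through z.
  pathsThrough : ∀ {k} → Assignment k → Assignment k → Assignment k → ℕ
  pathsThrough z a b = if inBox a z b then hamming a z ! * hamming z b ! else 0

  pathsThrough-sym : ∀ {k} (z a b : Assignment k) → pathsThrough z a b ≡ pathsThrough z b a
  pathsThrough-sym z a b rewrite inBox-sym a z b | hamming-sym a z | hamming-sym z b with inBox b z a
  ... | true  = *-comm (hamming z a !) (hamming b z !)
  ... | false = refl

  pathsThrough-first-step : ∀ {k} (z a b : Assignment k) {d} → hamming a z ≡ suc d →
    pathsThrough z a b ≡ sum (map (λ i → if lookup a i == lookup b i then 0 else pathsThrough z (flipAt a i) b) (allFin k))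
  pathsThrough-first-step {k} z a b {d} a≠z with inBox a z b in box
  ... | true = sym (begin
    sum (map (λ i → if lookup a i == lookup b i then 0 else pathsThrough z (flipAt a i) b) (allFin k))
      ≡⟨ cong sum (map-cong via (allFin k)) ⟩
    sum (map (λ i → if lookup a i == lookup z i then 0 else d ! * hamming z b !) (allFin k))
      ≡⟨ sum-differing a z _ (d ! * hamming z b !) (λ _ _ → refl) ⟩
    hamming a z * (d ! * hamming z b !)
      ≡⟨ cong (λ h → h * (d ! * hamming z b !)) a≠z ⟩
    suc d * (d ! * hamming z b !)
      ≡⟨ *-assoc (suc d) (d !) (hamming z b !) ⟨
    suc d ! * hamming z b !
      ≡⟨ cong (λ h → h ! * hamming z b !) a≠z ⟨
    hamming a z ! * hamming z b ! ∎)
    where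
    open ≡-Reasoning
    via : ∀ i → (if lookup a i == lookup b i then 0 else pathsThrough z (flipAt a i) b)
              ≡ (if lookup a i == lookup z i then 0 else d ! * hamming z b !)
    via i with lookup a i == lookup b i in aᵢ≠bᵢ | lookup a i == lookup z i in aᵢ≠zᵢ
    ... | true  | true  = refl
    ... | true  | false with () ← trans (sym aᵢ≠bᵢ) (inBox-differs a z b i box aᵢ≠zᵢ)
    ... | false | true  rewrite inBox-flipAt a z b i aᵢ≠bᵢ | box | aᵢ≠zᵢ = refl
    ... | false | false rewrite inBox-flipAt a z b i aᵢ≠bᵢ | box | aᵢ≠zᵢ =
      cong (λ h → h ! * hamming z b !) (suc-injective (trans (sym (hamming-flipAt a z i aᵢ≠zᵢ)) a≠z))
  ... | false = sym (begin
    sum (map (λ i → if lookup a i == lookup b i then 0 else pathsThrough z (flipAt a i) b) (allFin k))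
      ≡⟨ sum-differing a b _ 0 outside ⟩
    hamming a b * 0
      ≡⟨ *-zeroʳ (hamming a b) ⟩
    0 ∎)
    where
    open ≡-Reasoning
    outside : ∀ i → (lookup a i == lookup b i) ≡ false → pathsThrough z (flipAt a i) b ≡ 0
    outside i aᵢ≠bᵢ rewrite inBox-flipAt a z b i aᵢ≠bᵢ | box = refl

  sum-map-+ : ∀ {A : Set} (f g : A → ℕ) xs → sum (map (λ x → f x + g x) xs) ≡ sum (map f xs) + sum (map g xs)
  sum-map-+ f g []       = refl
  sum-map-+ f g (x ∷ xs) rewrite sum-map-+ f g xs = interchange (f x) (g x) (sum (map f xs)) (sum (map g xs))

  count-flipPaths-suc : ∀ {k} (C : Clause k) n (a b : Assignment k) →
    count (allSatisfy C) (flipPaths (suc n) a b) ≡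
    sum (map (λ i → if lookup a i == lookup b i then 0
                    else (if satisfies a C then count (allSatisfy C) (flipPaths n (flipAt a i) b) else 0))
             (allFin k))
  count-flipPaths-suc {k} C n a b =
    trans (count-concatMap (allSatisfy C) (flipPathsVia n a b) (allFin k)) (cong sum (map-cong via (allFin k)))
    where
    via : ∀ i → count (allSatisfy C) (flipPathsVia n a b i) ≡
                (if lookup a i == lookup b i then 0
                 else (if satisfies a C then count (allSatisfy C) (flipPaths n (flipAt a i) b) else 0))
    via i = trans (if-float (count (allSatisfy C)) (lookup a i == lookup b i))
      (cong (if lookup a i == lookup b i then 0 else_)
        (trans (count-map-++ (allSatisfy C) (allSatisfy-++ C) (a ∷ []) (flipPaths n (flipAt a i) b))
               (cong (if_then count (allSatisfy C) (flipPaths n (flipAt a i) b) else 0) (∧-identityʳ (satisfies a C)))))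

  count-good-flipPaths : ∀ {k} (C : Clause k) n (a b : Assignment k) → hamming a b ≡ n →
    count (allSatisfy C) (flipPaths n a b) + pathsThrough (falsifier C) a b ≡ n !
  count-good-flipPaths C zero a b h with hamming≡0⇒≡ {a = a} {b} h
  ... | refl rewrite inBox-self a (falsifier C) | satisfies≡not-eqA-falsifier a C with eqA a (falsifier C) in a≡z
  ...   | false = refl
  ...   | true with eqA⇒≡ {a = a} {falsifier C} a≡z
  ...     | refl rewrite hamming-refl (falsifier C) = refl
  count-good-flipPaths {k} C (suc n) a b h with satisfies a C in sat
  ... | false = cong₂ _+_ no-good all-bad
    where
    z : Assignment k
    z = falsifier C
    a≡z : a ≡ z
    a≡z = eqA⇒≡ (not-false⇒true (trans (sym (satisfies≡not-eqA-falsifier a C)) sat))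
      where not-false⇒true : ∀ {x} → not x ≡ false → x ≡ true
            not-false⇒true {true} _ = refl
    no-good : count (allSatisfy C) (flipPaths (suc n) a b) ≡ 0
    no-good rewrite count-flipPaths-suc C n a b | sat =
      trans (sum-differing a b (λ _ → 0) 0 (λ _ _ → refl)) (*-zeroʳ (hamming a b))
    all-bad : pathsThrough z a b ≡ suc n !
    all-bad rewrite a≡z | inBox-start z b | hamming-refl z = trans (+-identityʳ _) (cong _! (trans (cong (λ v → hamming v b) (sym a≡z)) h))
  ... | true = begin
    count (allSatisfy C) (flipPaths (suc n) a b) + pathsThrough z a b
      ≡⟨ cong₂ _+_ good-first-step (pathsThrough-first-step z a b (proj₂ (satisfies⇒differs-falsifier a C sat))) ⟩
    sum (map (λ i → if lookup a i == lookup b i then 0 else G i) (allFin k)) +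
    sum (map (λ i → if lookup a i == lookup b i then 0 else B i) (allFin k))
      ≡⟨ sum-map-+ (λ i → if lookup a i == lookup b i then 0 else G i) (λ i → if lookup a i == lookup b i then 0 else B i) (allFin k) ⟨
    sum (map (λ i → (if lookup a i == lookup b i then 0 else G i) + (if lookup a i == lookup b i then 0 else B i)) (allFin k))
      ≡⟨ cong sum (map-cong (λ i → if-0-+ (lookup a i == lookup b i)) (allFin k)) ⟩
    sum (map (λ i → if lookup a i == lookup b i then 0 else G i + B i) (allFin k))
      ≡⟨ sum-differing a b (λ i → G i + B i) (n !) (λ i aᵢ≠bᵢ →
           count-good-flipPaths C n (flipAt a i) b (suc-injective (trans (sym (hamming-flipAt a b i aᵢ≠bᵢ)) h))) ⟩
    hamming a b * n !
      ≡⟨ cong (_* n !) h ⟩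
    suc n ! ∎
    where
    open ≡-Reasoning
    z : Assignment k
    z = falsifier C
    G B : Fin k → ℕ
    G i = count (allSatisfy C) (flipPaths n (flipAt a i) b)
    B i = pathsThrough z (flipAt a i) b
    good-first-step : count (allSatisfy C) (flipPaths (suc n) a b) ≡
                      sum (map (λ i → if lookup a i == lookup b i then 0 else G i) (allFin k))
    good-first-step = trans (count-flipPaths-suc C n a b)
      (cong (λ s → sum (map (λ i → if lookup a i == lookup b i then 0 else (if s then G i else 0)) (allFin k))) sat)
    if-0-+ : ∀ c {x y} → (if c then 0 else x) + (if c then 0 else y) ≡ (if c then 0 else x + y)
    if-0-+ true  = refl
    if-0-+ false = refl

  length-𝔸 : ∀ {k} (a b : Assignment k) → length (𝔸 a b) ≡ hamming a b !
  length-𝔸 a b = trans (↭-length (𝔸↭flipPaths a b)) (length-flipPaths (hamming a b) a b refl)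

  count-good-𝔸 : ∀ {k} (C : Clause k) (a b : Assignment k) →
    count (allSatisfy C) (𝔸 a b) + pathsThrough (falsifier C) a b ≡ length (𝔸 a b)
  count-good-𝔸 C a b = begin
    count (allSatisfy C) (𝔸 a b) + pathsThrough (falsifier C) a b
      ≡⟨ cong (_+ pathsThrough (falsifier C) a b) (count-↭ (allSatisfy C) (𝔸↭flipPaths a b)) ⟩
    count (allSatisfy C) (flipPaths (hamming a b) a b) + pathsThrough (falsifier C) a b
      ≡⟨ count-good-flipPaths C (hamming a b) a b refl ⟩
    hamming a b !
      ≡⟨ length-𝔸 a b ⟨
    length (𝔸 a b) ∎
    where open ≡-Reasoning

module Binomials where

  open import Data.List using (_∷_; applyUpTo)
  open import Data.Nat using (ℕ; zero; suc; _+_; _*_; _∸_; _^_; _!; _≤_; _<_; z≤n; s≤s; NonZero; ≢-nonZero⁻¹)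
  open import Data.Nat.Combinatorics using (_C_; nCk≡n!/k![n-k]!; k![n∸k]!∣n!; nC1≡n; nCk+nC[k+1]≡[n+1]C[k+1])
  open import Data.Nat.DivMod using (_/_; m/n*n≡m)
  open import Data.Nat.ListAction using (sum)
  open import Data.Nat.Properties
  open import Algebra.Properties.CommutativeSemigroup +-commutativeSemigroup using (interchange)
  open import Data.Nat.Solver using (module +-*-Solver)
  open import Function using (_∘_)
  open import Relation.Binary.PropositionalEquality
  open import Relation.Nullary using (contradiction)

  C-factorial : ∀ m r → ((m + r) C m) * (m ! * r !) ≡ (m + r) !
  C-factorial m r = begin
    ((m + r) C m) * (m ! * r !)           ≡⟨ cong (λ x → ((m + r) C m) * (m ! * x !)) (m+n∸m≡n m r) ⟨
    ((m + r) C m) * (m ! * (m + r ∸ m) !) ≡⟨ cong (_* (m ! * (m + r ∸ m) !)) (nCk≡n!/k![n-k]! (m≤m+n m r)) ⟩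
    ((m + r) ! / (m ! * (m + r ∸ m) !)) * (m ! * (m + r ∸ m) !) ≡⟨ m/n*n≡m (k![n∸k]!∣n! (m≤m+n m r)) ⟩
    (m + r) !                           ∎
    where
    open ≡-Reasoning
    instance
      nonZero : NonZero (m ! * (m + r ∸ m) !)
      nonZero = _!*_!≢0 m (m + r ∸ m)

  C-positive : ∀ {n k} → k ≤ n → 0 < n C k
  C-positive {n} {k} k≤n = subst (λ x → 0 < x C k) (m+[n∸m]≡n k≤n) (positive (n ∸ k))
    where
    positive : ∀ r → 0 < (k + r) C k
    positive r with (k + r) C k | C-factorial k r
    ... | suc _ | _      = s≤s z≤n
    ... | zero  | 0≡fact = contradiction (sym 0≡fact) (≢-nonZero⁻¹ ((k + r) !) {{(k + r) !≢0}})

  suc-n≤C : ∀ n k → k < n → suc n ≤ suc n C suc k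
  suc-n≤C n       zero    _         = ≤-reflexive (sym (nC1≡n (suc n)))
  suc-n≤C (suc n) (suc k) (s≤s k<n) = begin
    suc (suc n)                                 ≡⟨ +-comm 1 (suc n) ⟩
    suc n + 1                                   ≤⟨ +-mono-≤ (suc-n≤C n k k<n) (C-positive (s≤s k<n)) ⟩
    suc n C suc k + suc n C suc (suc k)         ≡⟨ nCk+nC[k+1]≡[n+1]C[k+1] (suc n) (suc k) ⟩
    suc (suc n) C suc (suc k)                   ∎
    where open ≤-Reasoning

  applyUpTo-cong : ∀ {A : Set} {f g : ℕ → A} → (∀ m → f m ≡ g m) → ∀ n → applyUpTo f n ≡ applyUpTo g n
  applyUpTo-cong f≗g zero    = refl
  applyUpTo-cong f≗g (suc n) = cong₂ _∷_ (f≗g 0) (applyUpTo-cong (f≗g ∘ suc) n)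

  sum-applyUpTo-+ : ∀ (f g : ℕ → ℕ) n → sum (applyUpTo (λ m → f m + g m) n) ≡ sum (applyUpTo f n) + sum (applyUpTo g n)
  sum-applyUpTo-+ f g zero    = refl
  sum-applyUpTo-+ f g (suc n) rewrite sum-applyUpTo-+ (f ∘ suc) (g ∘ suc) n =
    interchange (f 0) (g 0) (sum (applyUpTo (f ∘ suc) n)) (sum (applyUpTo (g ∘ suc) n))

  sum-applyUpTo-shift : ∀ (f : ℕ → ℕ) d n → sum (applyUpTo (f ∘ (d +_)) n) ≤ sum (applyUpTo f (d + n))
  sum-applyUpTo-shift f zero    n = ≤-refl
  sum-applyUpTo-shift f (suc d) n = ≤-trans (sum-applyUpTo-shift (f ∘ suc) d n) (m≤n+m _ (f 0))

  -- Any range longer than K will do: the coefficients past K vanish.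
  sum-binomials : ∀ K n → K < n → sum (applyUpTo (K C_) n) ≡ 2 ^ K
  sum-binomials zero    (suc n) _ = cong suc (zeros n)
    where
    zeros : ∀ n → sum (applyUpTo (λ m → 0 C suc m) n) ≡ 0
    zeros zero    = refl
    zeros (suc n) = zeros n
  sum-binomials (suc K) (suc n) (s≤s K<n) = begin
    1 + sum (applyUpTo (λ m → suc K C suc m) n)
      ≡⟨ cong (λ s → 1 + s) (cong sum (applyUpTo-cong (λ m → sym (nCk+nC[k+1]≡[n+1]C[k+1] K m)) n)) ⟩
    1 + sum (applyUpTo (λ m → K C m + K C suc m) n)
      ≡⟨ cong (1 +_) (sum-applyUpTo-+ (K C_) (λ m → K C suc m) n) ⟩
    1 + (sum (applyUpTo (K C_) n) + sum (applyUpTo (λ m → K C suc m) n))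
      ≡⟨ solve 2 (λ s t → con 1 :+ (s :+ t) := s :+ (con 1 :+ t)) refl (sum (applyUpTo (K C_) n)) (sum (applyUpTo (λ m → K C suc m) n)) ⟩
    sum (applyUpTo (K C_) n) + sum (applyUpTo (K C_) (suc n))
      ≡⟨ cong₂ _+_ (sum-binomials K n K<n) (sum-binomials K (suc n) (m<n⇒m<1+n K<n)) ⟩
    2 ^ K + 2 ^ K
      ≡⟨ cong (2 ^ K +_) (+-identityʳ (2 ^ K)) ⟨
    2 ^ suc K ∎
    where
    open ≡-Reasoning
    open +-*-Solver

  -- Both sides times r ! are factorial products; the inequality is then d + N ≤ (d + N) C d.
  C-weight-bound : ∀ d m r → 0 < d → 0 < m + r →
    ((m + r) C m) * (d ! * m !) * (d + (m + r)) ≤ ((d + (m + r)) C (d + m)) * (d + m) !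
  C-weight-bound d@(suc d′) m r _ 0<N = *-cancelʳ-≤ _ _ (r !) {{r !≢0}} (begin
    ((m + r) C m) * (d ! * m !) * K * r !
      ≡⟨ solve 5 (λ B D M K R → B :* (D :* M) :* K :* R := (B :* (M :* R)) :* (K :* D)) refl ((m + r) C m) (d !) (m !) K (r !) ⟩
    (((m + r) C m) * (m ! * r !)) * (K * d !)
      ≡⟨ cong (_* (K * d !)) (C-factorial m r) ⟩
    (m + r) ! * (K * d !)
      ≡⟨ solve 3 (λ F K D → F :* (K :* D) := K :* (D :* F)) refl ((m + r) !) K (d !) ⟩
    K * (d ! * (m + r) !)
      ≤⟨ *-monoˡ-≤ (d ! * (m + r) !) (suc-n≤C (d′ + (m + r)) d′ (m<m+n d′ 0<N)) ⟩
    (K C d) * (d ! * (m + r) !)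
      ≡⟨ C-factorial d (m + r) ⟩
    K !
      ≡⟨ cong _! (+-assoc d m r) ⟨
    ((d + m) + r) !
      ≡⟨ C-factorial (d + m) r ⟨
    (((d + m) + r) C (d + m)) * ((d + m) ! * r !)
      ≡⟨ cong (λ n → (n C (d + m)) * ((d + m) ! * r !)) (+-assoc d m r) ⟩
    (K C (d + m)) * ((d + m) ! * r !)
      ≡⟨ *-assoc (K C (d + m)) ((d + m) !) (r !) ⟨
    (K C (d + m)) * (d + m) ! * r ! ∎)
    where
    open ≤-Reasoning
    open +-*-Solver
    K : ℕ
    K = d + (m + r)

  n≤2^n : ∀ n → n ≤ 2 ^ n
  n≤2^n zero    = z≤n
  n≤2^n (suc n) = +-mono-≤ (m^n>0 2 n) (≤-trans (n≤2^n n) (≤-reflexive (sym (+-identityʳ (2 ^ n)))))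

module Fractions where

  open Binomials
  import Data.Integer as ℤ
  import Data.Integer.Properties as ℤ
  import Data.Integer.Solver as ℤ-Solver
  open import Data.List using (List; []; _∷_; map; applyUpTo; upTo; length)
  open import Data.List.Properties using (map-applyUpTo; map-cong)
  open import Data.Nat as ℕ using (ℕ; zero; suc; NonZero; _!; _^_)
  open import Data.Nat.Combinatorics using (_C_; nCk+nC[k+1]≡[n+1]C[k+1]; k>n⇒nCk≡0)
  open import Data.Nat.ListAction using (sum)
  import Data.Nat.Properties as ℕ
  open import Data.Rational using (ℚ; 0ℚ; 1ℚ; _+_; _*_; _-_; _≤_; -_; toℚᵘ)
  import Data.Rational.Properties as ℚ
  open import Data.Rational.Solver using (module +-*-Solver)
  open import Data.Rational.Unnormalised as ℚᵘ using (mkℚᵘ; *≡*; *≤*)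
  import Data.Rational.Unnormalised.Properties as ℚᵘ
  open import Function using (id; _∘_)
  open import Relation.Binary.PropositionalEquality
  open import Relation.Nullary using (yes; no)
  open import Algebra.Bundles using (CommutativeMonoid)
  open import Algebra.Properties.CommutativeSemigroup (CommutativeMonoid.commutativeSemigroup ℚ.+-0-commutativeMonoid)
    using (interchange)

  -- frac n (suc d) unfolds to fromℚᵘ (mkℚᵘ (+ n) d).
  toℚᵘ-frac : ∀ n d → toℚᵘ (frac n (suc d)) ℚᵘ.≃ mkℚᵘ (ℤ.+ n) d
  toℚᵘ-frac n d = ℚ.toℚᵘ-fromℚᵘ (mkℚᵘ (ℤ.+ n) d)

  frac-≤ : ∀ a b c d .{{_ : NonZero b}} .{{_ : NonZero d}} → a ℕ.* d ℕ.≤ c ℕ.* b → frac a b ≤ frac c d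
  frac-≤ a (suc b) c (suc d) ad≤cb = ℚ.toℚᵘ-cancel-≤
    (ℚᵘ.≤-respˡ-≃ (ℚᵘ.≃-sym (toℚᵘ-frac a b)) (ℚᵘ.≤-respʳ-≃ (ℚᵘ.≃-sym (toℚᵘ-frac c d))
      (*≤* (subst₂ ℤ._≤_ (ℤ.pos-* a (suc d)) (ℤ.pos-* c (suc b)) (ℤ.+≤+ ad≤cb)))))

  frac-cong : ∀ a b c d .{{_ : NonZero b}} .{{_ : NonZero d}} → a ℕ.* d ≡ c ℕ.* b → frac a b ≡ frac c d
  frac-cong a b c d ad≡cb = ℚ.≤-antisym (frac-≤ a b c d (ℕ.≤-reflexive ad≡cb)) (frac-≤ c d a b (ℕ.≤-reflexive (sym ad≡cb)))

  frac-* : ∀ a b c d .{{_ : NonZero b}} .{{_ : NonZero d}} →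
    frac (a ℕ.* c) (b ℕ.* d) ≡ frac a b * frac c d
  frac-* a (suc b) c (suc d) = ℚ.toℚᵘ-injective (begin
    toℚᵘ (frac (a ℕ.* c) (suc b ℕ.* suc d))      ≈⟨ toℚᵘ-frac (a ℕ.* c) (d ℕ.+ b ℕ.* suc d) ⟩
    mkℚᵘ (ℤ.+ (a ℕ.* c)) (d ℕ.+ b ℕ.* suc d)       ≡⟨ cong (λ x → mkℚᵘ x (d ℕ.+ b ℕ.* suc d)) (ℤ.pos-* a c) ⟩
    mkℚᵘ (ℤ.+ a) b ℚᵘ.* mkℚᵘ (ℤ.+ c) d             ≈⟨ ℚᵘ.*-cong (toℚᵘ-frac a b) (toℚᵘ-frac c d) ⟨
    toℚᵘ (frac a (suc b)) ℚᵘ.* toℚᵘ (frac c (suc d)) ≈⟨ ℚ.toℚᵘ-homo-* (frac a (suc b)) (frac c (suc d)) ⟨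
    toℚᵘ (frac a (suc b) * frac c (suc d))      ∎)
    where open ℚᵘ.≃-Reasoning

  frac-+ : ∀ a c b .{{_ : NonZero b}} → frac a b + frac c b ≡ frac (a ℕ.+ c) b
  frac-+ a c (suc b) = ℚ.toℚᵘ-injective (begin
    toℚᵘ (frac a (suc b) + frac c (suc b))            ≈⟨ ℚ.toℚᵘ-homo-+ (frac a (suc b)) (frac c (suc b)) ⟩
    toℚᵘ (frac a (suc b)) ℚᵘ.+ toℚᵘ (frac c (suc b))  ≈⟨ ℚᵘ.+-cong (toℚᵘ-frac a b) (toℚᵘ-frac c b) ⟩
    mkℚᵘ (ℤ.+ a) b ℚᵘ.+ mkℚᵘ (ℤ.+ c) b                    ≈⟨ *≡* cross ⟩
    mkℚᵘ (ℤ.+ (a ℕ.+ c)) b                              ≈⟨ toℚᵘ-frac (a ℕ.+ c) b ⟨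
    toℚᵘ (frac (a ℕ.+ c) (suc b))                     ∎)
    where
    open ℚᵘ.≃-Reasoning
    open ℤ-Solver.+-*-Solver
    cross : ((ℤ.+ a) ℤ.* (ℤ.+ suc b) ℤ.+ (ℤ.+ c) ℤ.* (ℤ.+ suc b)) ℤ.* (ℤ.+ suc b) ≡
            (ℤ.+ (a ℕ.+ c)) ℤ.* (ℤ.+ (suc b ℕ.* suc b))
    cross = trans (solve 3 (λ A C S → (A :* S :+ C :* S) :* S := (A :+ C) :* (S :* S)) refl (ℤ.+ a) (ℤ.+ c) (ℤ.+ suc b))
                  (sym (cong₂ ℤ._*_ (ℤ.pos-+ a c) (ℤ.pos-* (suc b) (suc b))))

  frac-zero : ∀ b → frac 0 b ≡ 0ℚ
  frac-zero zero    = refl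
  frac-zero (suc b) = frac-cong 0 (suc b) 0 1 refl

  frac-nonneg : ∀ a b → 0ℚ ≤ frac a b
  frac-nonneg a zero    = ℚ.≤-refl
  frac-nonneg a (suc b) = subst (_≤ frac a (suc b)) (frac-zero 1) (frac-≤ 0 1 a (suc b) ℕ.z≤n)

  frac-self : ∀ n .{{_ : NonZero n}} → frac n n ≡ 1ℚ
  frac-self n = frac-cong n n 1 1 (ℕ.*-comm n 1)

  frac-complement : ∀ g b n .{{_ : NonZero n}} → g ℕ.+ b ≡ n → frac g n ≡ 1ℚ - frac b n
  frac-complement g b n g+b≡n = begin
    frac g n                          ≡⟨ ℚ.+-identityʳ (frac g n) ⟨
    frac g n + 0ℚ                     ≡⟨ cong (frac g n +_) (ℚ.+-inverseʳ (frac b n)) ⟨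
    frac g n + (frac b n - frac b n)  ≡⟨ ℚ.+-assoc (frac g n) (frac b n) _ ⟨
    (frac g n + frac b n) - frac b n  ≡⟨ cong (_- frac b n) (trans (frac-+ g b n) (trans (cong (λ m → frac m n) g+b≡n) (frac-self n))) ⟩
    1ℚ - frac b n                     ∎
    where open ≡-Reasoning

  frac-cancel : ∀ n b .{{_ : NonZero n}} .{{_ : NonZero b}} → frac 1 n * frac n b ≡ frac 1 b
  frac-cancel n b = trans (sym (frac-* 1 n n b)) (frac-cong (1 ℕ.* n) (n ℕ.* b) 1 b {{ℕ.m*n≢0 n b}} (ℕ.*-assoc 1 n b))

  p-q≤p : ∀ p {q} → 0ℚ ≤ q → p - q ≤ p
  p-q≤p p 0≤q = ℚ.≤-trans (ℚ.+-monoʳ-≤ p (ℚ.neg-antimono-≤ 0≤q)) (ℚ.≤-reflexive (ℚ.+-identityʳ p))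

  -- With x = b₁/n₁ and y = b₂/n₂ the left side is (1 - x)(1 - y) + x + y = 1 + x y.
  union-bound : ∀ g₁ b₁ n₁ g₂ b₂ n₂ .{{_ : NonZero n₁}} .{{_ : NonZero n₂}} →
    g₁ ℕ.+ b₁ ≡ n₁ → g₂ ℕ.+ b₂ ≡ n₂ →
    1ℚ ≤ (frac (g₁ ℕ.* g₂) (n₁ ℕ.* n₂) + frac b₁ n₁) + frac b₂ n₂
  union-bound g₁ b₁ n₁ g₂ b₂ n₂ g₁+b₁≡n₁ g₂+b₂≡n₂ = begin
    1ℚ
      ≡⟨ solve 2 (λ x y → con 1ℚ := (((con 1ℚ :- x) :* (con 1ℚ :- y) :- x :* y) :+ x) :+ y) refl x y ⟩
    (((1ℚ - x) * (1ℚ - y) - x * y) + x) + y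
      ≤⟨ ℚ.+-monoˡ-≤ y (ℚ.+-monoˡ-≤ x (p-q≤p ((1ℚ - x) * (1ℚ - y)) xy≥0)) ⟩
    ((1ℚ - x) * (1ℚ - y) + x) + y
      ≡⟨ cong (λ u → (u + x) + y)
              (cong₂ _*_ (frac-complement g₁ b₁ n₁ g₁+b₁≡n₁) (frac-complement g₂ b₂ n₂ g₂+b₂≡n₂)) ⟨
    (frac g₁ n₁ * frac g₂ n₂ + x) + y
      ≡⟨ cong (λ u → (u + x) + y) (frac-* g₁ n₁ g₂ n₂) ⟨
    (frac (g₁ ℕ.* g₂) (n₁ ℕ.* n₂) + x) + y ∎
    where
    open ℚ.≤-Reasoning
    open +-*-Solver
    x y : ℚ
    x = frac b₁ n₁
    y = frac b₂ n₂
    instance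
      n₁n₂≢0 : NonZero (n₁ ℕ.* n₂)
      n₁n₂≢0 = ℕ.m*n≢0 n₁ n₂
    xy≥0 : 0ℚ ≤ x * y
    xy≥0 = subst (0ℚ ≤_) (frac-* b₁ n₁ b₂ n₂) (frac-nonneg (b₁ ℕ.* b₂) (n₁ ℕ.* n₂))

  sumℚ-map-+ : ∀ {A : Set} (f g : A → ℚ) xs → sumℚ (map (λ x → f x + g x) xs) ≡ sumℚ (map f xs) + sumℚ (map g xs)
  sumℚ-map-+ f g []       = sym (ℚ.+-identityʳ 0ℚ)
  sumℚ-map-+ f g (x ∷ xs) rewrite sumℚ-map-+ f g xs = interchange (f x) (g x) (sumℚ (map f xs)) (sumℚ (map g xs))

  sumℚ-map-mono : ∀ {A : Set} {f g : A → ℚ} xs → (∀ x → f x ≤ g x) → sumℚ (map f xs) ≤ sumℚ (map g xs)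
  sumℚ-map-mono []       f≤g = ℚ.≤-refl
  sumℚ-map-mono (x ∷ xs) f≤g = ℚ.+-mono-≤ (f≤g x) (sumℚ-map-mono xs f≤g)

  sumℚ-map-zero : ∀ {A : Set} {f : A → ℚ} xs → (∀ x → f x ≡ 0ℚ) → sumℚ (map f xs) ≡ 0ℚ
  sumℚ-map-zero []       f≡0 = refl
  sumℚ-map-zero (x ∷ xs) f≡0 = trans (cong₂ _+_ (f≡0 x) (sumℚ-map-zero xs f≡0)) (ℚ.+-identityʳ 0ℚ)

  sumℚ-map-one : ∀ {A : Set} (xs : List A) → sumℚ (map (λ _ → 1ℚ) xs) ≡ frac (length xs) 1
  sumℚ-map-one []       = refl
  sumℚ-map-one (x ∷ xs) = trans (cong (1ℚ +_) (sumℚ-map-one xs)) (frac-+ 1 (length xs) 1)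

  sumℚ-applyUpTo : ∀ (f : ℕ → ℚ) n → sumℚ (applyUpTo f n) ≡ sumℚ (map f (upTo n))
  sumℚ-applyUpTo f n = cong sumℚ (sym (map-applyUpTo id f n))

  sumℚ-applyUpTo-frac : ∀ (c : ℕ → ℕ) n K .{{_ : NonZero K}} →
    sumℚ (applyUpTo (λ m → frac (c m) K) n) ≡ frac (sum (applyUpTo c n)) K
  sumℚ-applyUpTo-frac c zero    K = sym (frac-zero K)
  sumℚ-applyUpTo-frac c (suc n) K = trans (cong (frac (c 0) K +_) (sumℚ-applyUpTo-frac (c ∘ suc) n K)) (frac-+ (c 0) _ K)

  -- Σ_m (N C m) * g m (binomialSum≡), splitting off one of N free coordinates at a time.
  binomialSum : ℕ → (ℕ → ℚ) → ℚ
  binomialSum zero    g = g 0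
  binomialSum (suc N) g = binomialSum N g + binomialSum N (g ∘ suc)

  -- Any range longer than N will do: the coefficients past N vanish.
  binomialSum≡ : ∀ N n g → N ℕ.< n → binomialSum N g ≡ sumℚ (applyUpTo (λ m → frac (N C m) 1 * g m) n)
  binomialSum≡ zero (suc n) g _ = begin
    g 0                                                        ≡⟨ ℚ.+-identityʳ (g 0) ⟨
    g 0 + 0ℚ
      ≡⟨ cong₂ _+_ (ℚ.*-identityˡ (g 0)) (sumℚ-map-zero (upTo n) (λ m → ℚ.*-zeroˡ (g (suc m)))) ⟨
    1ℚ * g 0 + sumℚ (map (λ m → 0ℚ * g (suc m)) (upTo n))      ≡⟨ cong (1ℚ * g 0 +_) (sumℚ-applyUpTo (λ m → 0ℚ * g (suc m)) n) ⟨
    1ℚ * g 0 + sumℚ (applyUpTo (λ m → 0ℚ * g (suc m)) n)       ∎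
    where open ≡-Reasoning
  binomialSum≡ (suc N) (suc n) g (ℕ.s≤s N<n) = begin
    binomialSum N g + binomialSum N (g ∘ suc)
      ≡⟨ cong₂ _+_ (binomialSum≡ N (suc n) g (ℕ.m<n⇒m<1+n N<n)) (binomialSum≡ N n (g ∘ suc) N<n) ⟩
    (g₀ + sumℚ (applyUpTo (λ m → frac (N C suc m) 1 * g (suc m)) n)) + sumℚ (applyUpTo (λ m → frac (N C m) 1 * g (suc m)) n)
      ≡⟨ ℚ.+-assoc g₀ _ _ ⟩
    g₀ + (sumℚ (applyUpTo (λ m → frac (N C suc m) 1 * g (suc m)) n) + sumℚ (applyUpTo (λ m → frac (N C m) 1 * g (suc m)) n))
      ≡⟨ cong (g₀ +_) (trans (cong₂ _+_ (sumℚ-applyUpTo _ n) (sumℚ-applyUpTo _ n)) (sym (sumℚ-map-+ _ _ (upTo n)))) ⟩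
    g₀ + sumℚ (map (λ m → frac (N C suc m) 1 * g (suc m) + frac (N C m) 1 * g (suc m)) (upTo n))
      ≡⟨ cong (g₀ +_) (trans (cong sumℚ (map-cong pascal (upTo n))) (sym (sumℚ-applyUpTo _ n))) ⟩
    g₀ + sumℚ (applyUpTo (λ m → frac (suc N C suc m) 1 * g (suc m)) n) ∎
    where
    open ≡-Reasoning
    g₀ : ℚ
    g₀ = frac 1 1 * g 0
    pascal : ∀ m → frac (N C suc m) 1 * g (suc m) + frac (N C m) 1 * g (suc m) ≡ frac (suc N C suc m) 1 * g (suc m)
    pascal m = begin
      frac (N C suc m) 1 * g (suc m) + frac (N C m) 1 * g (suc m) ≡⟨ ℚ.*-distribʳ-+ (g (suc m)) (frac (N C suc m) 1) (frac (N C m) 1) ⟨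
      (frac (N C suc m) 1 + frac (N C m) 1) * g (suc m)          ≡⟨ cong (_* g (suc m)) (frac-+ (N C suc m) (N C m) 1) ⟩
      frac (N C suc m ℕ.+ N C m) 1 * g (suc m)
        ≡⟨ cong (λ c → frac c 1 * g (suc m)) (trans (ℕ.+-comm (N C suc m) (N C m)) (nCk+nC[k+1]≡[n+1]C[k+1] N m)) ⟩
      frac (suc N C suc m) 1 * g (suc m)                         ∎

  -- Among the (d + m)! flip paths between assignments at distances d and m from z
  -- on either side of it, d! m! pass through z.
  throughFraction : ℕ → ℕ → ℚ
  throughFraction d m = frac (d ! ℕ.* m !) ((d ℕ.+ m) !)

  throughFraction-term≤ : ∀ d m r → 0 ℕ.< d → 0 ℕ.< m ℕ.+ r →
    frac ((m ℕ.+ r) C m) 1 * throughFraction d m ≤ frac ((d ℕ.+ (m ℕ.+ r)) C (d ℕ.+ m)) (d ℕ.+ (m ℕ.+ r))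
  throughFraction-term≤ d@(suc _) m r 0<d 0<N = begin
    frac ((m ℕ.+ r) C m) 1 * frac (d ! ℕ.* m !) ((d ℕ.+ m) !)    ≡⟨ frac-* ((m ℕ.+ r) C m) 1 (d ! ℕ.* m !) ((d ℕ.+ m) !) ⟨
    frac (((m ℕ.+ r) C m) ℕ.* (d ! ℕ.* m !)) (1 ℕ.* (d ℕ.+ m) !)
      ≤⟨ frac-≤ (((m ℕ.+ r) C m) ℕ.* (d ! ℕ.* m !)) (1 ℕ.* (d ℕ.+ m) !) (K C (d ℕ.+ m)) K cross ⟩
    frac (K C (d ℕ.+ m)) K                                       ∎
    where
    open ℚ.≤-Reasoning
    K : ℕ
    K = d ℕ.+ (m ℕ.+ r)
    instance
      [d+m]!≢0 : NonZero ((d ℕ.+ m) !)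
      [d+m]!≢0 = (d ℕ.+ m) ℕ.!≢0
      1*[d+m]!≢0 : NonZero (1 ℕ.* (d ℕ.+ m) !)
      1*[d+m]!≢0 = ℕ.m*n≢0 1 ((d ℕ.+ m) !)
    cross : ((m ℕ.+ r) C m) ℕ.* (d ! ℕ.* m !) ℕ.* K ℕ.≤ (K C (d ℕ.+ m)) ℕ.* (1 ℕ.* (d ℕ.+ m) !)
    cross = ℕ.≤-trans (C-weight-bound d m r 0<d 0<N) (ℕ.≤-reflexive (cong ((K C (d ℕ.+ m)) ℕ.*_) (sym (ℕ.*-identityˡ _))))

  sumℚ-applyUpTo-mono : ∀ {f g : ℕ → ℚ} n → (∀ m → f m ≤ g m) → sumℚ (applyUpTo f n) ≤ sumℚ (applyUpTo g n)
  sumℚ-applyUpTo-mono {f} {g} n f≤g =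
    subst₂ _≤_ (sym (sumℚ-applyUpTo f n)) (sym (sumℚ-applyUpTo g n)) (sumℚ-map-mono (upTo n) f≤g)

  binomialSum-throughFraction≤ : ∀ d N → 0 ℕ.< d → binomialSum N (throughFraction d) ≤ frac (2 ^ (d ℕ.+ N)) (d ℕ.+ N)
  binomialSum-throughFraction≤ d@(suc _) zero _ = frac-≤ (d ! ℕ.* 1) ((d ℕ.+ 0) !) (2 ^ (d ℕ.+ 0)) (d ℕ.+ 0) cross
    where
    instance
      [d+0]!≢0 : NonZero ((d ℕ.+ 0) !)
      [d+0]!≢0 = (d ℕ.+ 0) ℕ.!≢0
    cross : d ! ℕ.* 1 ℕ.* (d ℕ.+ 0) ℕ.≤ 2 ^ (d ℕ.+ 0) ℕ.* (d ℕ.+ 0) !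
    cross = subst (λ n → d ! ℕ.* 1 ℕ.* n ℕ.≤ 2 ^ n ℕ.* n !) (sym (ℕ.+-identityʳ d))
              (ℕ.≤-trans (ℕ.≤-reflexive (trans (cong (ℕ._* d) (ℕ.*-identityʳ (d !))) (ℕ.*-comm (d !) d)))
                         (ℕ.*-monoˡ-≤ (d !) (n≤2^n d)))
  binomialSum-throughFraction≤ d@(suc _) N@(suc _) 0<d = begin
    binomialSum N (throughFraction d)
      ≡⟨ binomialSum≡ N (suc N) (throughFraction d) ℕ.≤-refl ⟩
    sumℚ (applyUpTo (λ m → frac (N C m) 1 * throughFraction d m) (suc N))
      ≤⟨ sumℚ-applyUpTo-mono (suc N) term≤ ⟩
    sumℚ (applyUpTo (λ m → frac (K C (d ℕ.+ m)) K) (suc N))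
      ≡⟨ sumℚ-applyUpTo-frac (λ m → K C (d ℕ.+ m)) (suc N) K ⟩
    frac (sum (applyUpTo (λ m → K C (d ℕ.+ m)) (suc N))) K
      ≤⟨ frac-≤ (sum (applyUpTo (λ m → K C (d ℕ.+ m)) (suc N))) K (2 ^ K) K (ℕ.*-monoˡ-≤ K sum≤2^K) ⟩
    frac (2 ^ K) K ∎
    where
    open ℚ.≤-Reasoning
    K : ℕ
    K = d ℕ.+ N
    sum≤2^K : sum (applyUpTo (λ m → K C (d ℕ.+ m)) (suc N)) ℕ.≤ 2 ^ K
    sum≤2^K = ℕ.≤-trans (sum-applyUpTo-shift (K C_) d (suc N))
                        (ℕ.≤-reflexive (sum-binomials K (d ℕ.+ suc N) (ℕ.+-monoʳ-< d ℕ.≤-refl)))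
    term≤ : ∀ m → frac (N C m) 1 * throughFraction d m ≤ frac (K C (d ℕ.+ m)) K
    term≤ m with m ℕ.≤? N
    ... | yes m≤N = subst (λ n → frac (n C m) 1 * throughFraction d m ≤ frac ((d ℕ.+ n) C (d ℕ.+ m)) (d ℕ.+ n))
                          (ℕ.m+[n∸m]≡n m≤N)
                          (throughFraction-term≤ d m (N ℕ.∸ m) 0<d (subst (0 ℕ.<_) (sym (ℕ.m+[n∸m]≡n m≤N)) ℕ.z<s))
    ... | no  m≰N = begin
      frac (N C m) 1 * throughFraction d m  ≡⟨ cong (λ c → frac c 1 * throughFraction d m) (k>n⇒nCk≡0 (ℕ.≰⇒> m≰N)) ⟩
      frac 0 1 * throughFraction d m        ≡⟨ ℚ.*-zeroˡ (throughFraction d m) ⟩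
      0ℚ                                    ≤⟨ frac-nonneg (K C (d ℕ.+ m)) K ⟩
      frac (K C (d ℕ.+ m)) K                ∎

module Shares where

  open FlipPaths
  open Fractions
  open import Data.Bool using (Bool; true; false; not; if_then_else_)
  open import Data.Bool.Properties using (∨-zeroʳ; ∨-identityʳ)
  open import Data.List using (List; []; _∷_; map; concatMap; length)
  open import Data.List.Properties using (map-cong)
  open import Data.Nat as ℕ using (ℕ; suc; NonZero; _!; _^_; _∸_)
  import Data.Nat.Properties as ℕ
  open import Data.Product using (proj₂)
  open import Data.Rational using (ℚ; 0ℚ; 1ℚ; _+_; _*_; _-_; _≤_; -_; nonNegative)
  import Data.Rational.Properties as ℚ
  open import Data.Rational.Solver using (module +-*-Solver)
  open import Data.Vec using ([]; _∷_)
  open import Function using (_∘_)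
  open import Relation.Binary.PropositionalEquality

  sumℚ-pairs : ∀ {k} (F : Assignment (suc k) → ℚ) (L : List (Assignment k)) →
    sumℚ (map F (concatMap (λ v → (true ∷ v) ∷ (false ∷ v) ∷ []) L)) ≡ sumℚ (map (λ v → F (true ∷ v) + F (false ∷ v)) L)
  sumℚ-pairs F []      = refl
  sumℚ-pairs F (v ∷ L) =
    trans (sym (ℚ.+-assoc (F (true ∷ v)) (F (false ∷ v)) _)) (cong (F (true ∷ v) + F (false ∷ v) +_) (sumℚ-pairs F L))

  -- Grouping the assignments t with z in the box of a and t by m = hamming z t; there are
  -- (k ∸ hamming a z) C m of them, as t must agree with z wherever a does not.
  boxSum : ∀ {k} (a z : Assignment k) (g : ℕ → ℚ) →
    sumℚ (map (λ t → if inBox a z t then g (hamming z t) else 0ℚ) (allAssignments k)) ≡ binomialSum (k ∸ hamming a z) g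
  boxSum [] [] g = ℚ.+-identityʳ (g 0)
  boxSum {suc k} (x ∷ a) (y ∷ z) g = begin
    sumℚ (map F (allAssignments (suc k)))
      ≡⟨ sumℚ-pairs F (allAssignments k) ⟩
    sumℚ (map (λ v → F (true ∷ v) + F (false ∷ v)) (allAssignments k))
      ≡⟨ cong sumℚ (map-cong (λ v → trans (pair-sum y (λ b → F (b ∷ v))) (cong₂ _+_ (near v) (far v))) (allAssignments k)) ⟩
    sumℚ (map (λ v → T g v + (if y == x then T (g ∘ suc) v else 0ℚ)) (allAssignments k))
      ≡⟨ by-first-coordinate ⟩
    binomialSum (suc k ∸ hamming (x ∷ a) (y ∷ z)) g ∎
    where
    open ≡-Reasoning
    F : Assignment (suc k) → ℚ
    F t = if inBox (x ∷ a) (y ∷ z) t then g (hamming (y ∷ z) t) else 0ℚ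
    T : (ℕ → ℚ) → Assignment k → ℚ
    T h v = if inBox a z v then h (hamming z v) else 0ℚ
    pair-sum : ∀ y (f : Bool → ℚ) → f true + f false ≡ f y + f (not y)
    pair-sum true  f = refl
    pair-sum false f = ℚ.+-comm (f true) (f false)
    near : ∀ v → F (y ∷ v) ≡ T g v
    near v rewrite hamming-∷ y y z v | ==-refl y | ∨-zeroʳ (y == x) = refl
    far : ∀ v → F (not y ∷ v) ≡ (if y == x then T (g ∘ suc) v else 0ℚ)
    far v rewrite hamming-∷ y (not y) z v | ==-not y | ∨-identityʳ (y == x) with y == x
    ... | true  = refl
    ... | false = refl
    by-first-coordinate : sumℚ (map (λ v → T g v + (if y == x then T (g ∘ suc) v else 0ℚ)) (allAssignments k))
                            ≡ binomialSum (suc k ∸ hamming (x ∷ a) (y ∷ z)) g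
    by-first-coordinate rewrite hamming-∷ x y a z | ==-sym x y with y == x
    ... | true  = begin
      sumℚ (map (λ v → T g v + T (g ∘ suc) v) (allAssignments k))
        ≡⟨ sumℚ-map-+ (T g) (T (g ∘ suc)) (allAssignments k) ⟩
      sumℚ (map (T g) (allAssignments k)) + sumℚ (map (T (g ∘ suc)) (allAssignments k))
        ≡⟨ cong₂ _+_ (boxSum a z g) (boxSum a z (g ∘ suc)) ⟩
      binomialSum (suc (k ∸ hamming a z)) g
        ≡⟨ cong (λ n → binomialSum n g) (ℕ.+-∸-assoc 1 (hamming≤ a z)) ⟨
      binomialSum (suc k ∸ hamming a z) g ∎
    ... | false = trans (cong sumℚ (map-cong (λ v → ℚ.+-identityʳ (T g v)) (allAssignments k))) (boxSum a z g)

  length-𝔸-nonZero : ∀ {k} (a b : Assignment k) → NonZero (length (𝔸 a b))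
  length-𝔸-nonZero a b = subst NonZero (sym (length-𝔸 a b)) (hamming a b ℕ.!≢0)

  throughShare : ∀ {k} → Clause k → Assignment k → Assignment k → ℚ
  throughShare C a b = frac (pathsThrough (falsifier C) a b) (length (𝔸 a b))

  throughShare-sym : ∀ {k} (C : Clause k) (a b : Assignment k) → throughShare C a b ≡ throughShare C b a
  throughShare-sym C a b =
    cong₂ frac (pathsThrough-sym (falsifier C) a b)
               (trans (length-𝔸 a b) (trans (cong _! (hamming-sym a b)) (sym (length-𝔸 b a))))

  throughShare-inBox : ∀ {k} (C : Clause k) (a t : Assignment k) →
    throughShare C a t ≡ (if inBox a (falsifier C) t then throughFraction (hamming a (falsifier C)) (hamming (falsifier C) t) else 0ℚ)
  throughShare-inBox C a t with inBox a (falsifier C) t in box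
  ... | true  = cong (frac _) (trans (length-𝔸 a t) (cong _! (hamming-inBox a (falsifier C) t box)))
  ... | false = frac-zero (length (𝔸 a t))

  sum-throughShare≤ : ∀ {k} (C : Clause k) (a : Assignment k) → satisfies a C ≡ true →
    sumℚ (map (throughShare C a) (allAssignments k)) ≤ frac (2 ^ k) k
  sum-throughShare≤ {k} C a sat = begin
    sumℚ (map (throughShare C a) (allAssignments k))
      ≡⟨ cong sumℚ (map-cong (throughShare-inBox C a) (allAssignments k)) ⟩
    sumℚ (map (λ t → if inBox a z t then throughFraction d (hamming z t) else 0ℚ) (allAssignments k))
      ≡⟨ boxSum a z (throughFraction d) ⟩
    binomialSum (k ∸ d) (throughFraction d)
      ≤⟨ binomialSum-throughFraction≤ d (k ∸ d) 0<d ⟩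
    frac (2 ^ (d ℕ.+ (k ∸ d))) (d ℕ.+ (k ∸ d))
      ≡⟨ cong (λ n → frac (2 ^ n) n) (ℕ.m+[n∸m]≡n (hamming≤ a z)) ⟩
    frac (2 ^ k) k ∎
    where
    open ℚ.≤-Reasoning
    z : Assignment k
    z = falsifier C
    d : ℕ
    d = hamming a z
    0<d : 0 ℕ.< d
    0<d = subst (0 ℕ.<_) (sym (proj₂ (satisfies⇒differs-falsifier a C sat))) ℕ.z<s

  goodShare : ∀ {k} → Clause k → Assignment k → Assignment k → Assignment k → ℚ
  goodShare C s e t = frac (count (allSatisfy C) (𝔸₃ s t e)) (length (𝔸₃ s t e))

  goodShare-bound : ∀ {k} (C : Clause k) (s e t : Assignment k) →
    1ℚ ≤ (goodShare C s e t + throughShare C s t) + throughShare C e t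
  goodShare-bound C s e t =
    subst₂ (λ g h → 1ℚ ≤ (g + throughShare C s t) + h)
      (sym (cong₂ frac (count-𝔸₃ C s t e) (length-𝔸₃ s t e)))
      (throughShare-sym C t e)
      (union-bound _ _ _ _ _ _ {{length-𝔸-nonZero s t}} {{length-𝔸-nonZero t e}} (count-good-𝔸 C s t) (count-good-𝔸 C t e))

  sum-bounded-terms : ∀ {x y b₁ b₂ c} → x ≤ (y + b₁) + b₂ → b₁ ≤ c → b₂ ≤ c → (x - c) - c ≤ y
  sum-bounded-terms {x} {y} {b₁} {b₂} {c} x≤ b₁≤c b₂≤c = begin
    (x - c) - c
      ≤⟨ ℚ.+-monoˡ-≤ (- c) (ℚ.+-monoˡ-≤ (- c) (ℚ.≤-trans x≤ (ℚ.+-mono-≤ (ℚ.+-monoʳ-≤ y b₁≤c) b₂≤c))) ⟩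
    (((y + c) + c) - c) - c     ≡⟨ solve 2 (λ y c → (((y :+ c) :+ c) :- c) :- c := y) refl y c ⟩
    y                           ∎
    where
    open ℚ.≤-Reasoning
    open +-*-Solver

  sum-goodShare≥ : ∀ {k} (C : Clause k) (s e : Assignment k) → satisfies s C ≡ true → satisfies e C ≡ true →
    (frac (2 ^ k) 1 - frac (2 ^ k) k) - frac (2 ^ k) k ≤ sumℚ (map (goodShare C s e) (allAssignments k))
  sum-goodShare≥ {k} C s e sat-s sat-e = sum-bounded-terms total (sum-throughShare≤ C s sat-s) (sum-throughShare≤ C e sat-e)
    where
    open ℚ.≤-Reasoning
    L : List (Assignment k)
    L = allAssignments k
    total : frac (2 ^ k) 1 ≤ (sumℚ (map (goodShare C s e) L) + sumℚ (map (throughShare C s) L)) + sumℚ (map (throughShare C e) L)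
    total = begin
      frac (2 ^ k) 1                  ≡⟨ trans (sumℚ-map-one L) (cong (λ n → frac n 1) (length-allAssignments k)) ⟨
      sumℚ (map (λ _ → 1ℚ) L)         ≤⟨ sumℚ-map-mono L (goodShare-bound C s e) ⟩
      sumℚ (map (λ t → (goodShare C s e t + throughShare C s t) + throughShare C e t) L)
        ≡⟨ sumℚ-map-+ (λ t → goodShare C s e t + throughShare C s t) (throughShare C e) L ⟩
      sumℚ (map (λ t → goodShare C s e t + throughShare C s t) L) + sumℚ (map (throughShare C e) L)
        ≡⟨ cong (_+ sumℚ (map (throughShare C e) L)) (sumℚ-map-+ (goodShare C s e) (throughShare C s) L) ⟩
      (sumℚ (map (goodShare C s e) L) + sumℚ (map (throughShare C s) L)) + sumℚ (map (throughShare C e) L) ∎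

  Pr≥1-2/k : ∀ k .{{_ : NonZero k}} (C : Clause k) (s e : Assignment k) → satisfies s C ≡ true → satisfies e C ≡ true →
    (1ℚ - frac 1 k) - frac 1 k ≤ Pr k C s e
  Pr≥1-2/k k C s e sat-s sat-e = begin
    (1ℚ - frac 1 k) - frac 1 k
      ≡⟨ cong₂ (λ u v → (u - v) - v) (frac-cancel (2 ^ k) 1) (frac-cancel (2 ^ k) k) ⟨
    (c * frac (2 ^ k) 1 - c * frac (2 ^ k) k) - c * frac (2 ^ k) k
      ≡⟨ solve 3 (λ c A B → (c :* A :- c :* B) :- c :* B := c :* ((A :- B) :- B)) refl c (frac (2 ^ k) 1) (frac (2 ^ k) k) ⟩
    c * ((frac (2 ^ k) 1 - frac (2 ^ k) k) - frac (2 ^ k) k)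
      ≤⟨ ℚ.*-monoˡ-≤-nonNeg c {{nonNegative (frac-nonneg 1 (2 ^ k))}} (sum-goodShare≥ C s e sat-s sat-e) ⟩
    Pr k C s e ∎
    where
    open ℚ.≤-Reasoning
    open +-*-Solver
    c : ℚ
    c = frac 1 (2 ^ k)
    instance
      2^k≢0 : NonZero (2 ^ k)
      2^k≢0 = ℕ.m^n≢0 2 k

open Fractions using (frac-≤)
open Shares using (Pr≥1-2/k)
open import Data.Bool using (true)
open import Data.Nat using (ℕ; _≤_; _∸_; suc; s≤s)
import Data.Nat.Properties as ℕ
open import Data.Rational using (1ℚ; _-_; -_) renaming (_≤_ to _≤ℚ_)
import Data.Rational.Properties as ℚ
open import Relation.Binary.PropositionalEquality using (_≡_)

lemma8p2 : (k : ℕ) → 3 ≤ k → (C : Clause k) → (αstart αend : Assignment k) →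
    satisfies αstart C ≡ true → satisfies αend C ≡ true →
    ((1ℚ - frac 1 (k ∸ 1)) - frac 1 k) ≤ℚ Pr k C αstart αend
lemma8p2 k@(suc (suc (suc _))) (s≤s (s≤s (s≤s _))) C αstart αend sat-start sat-end = begin
  (1ℚ - frac 1 (k ∸ 1)) - frac 1 k  ≤⟨ ℚ.+-monoˡ-≤ (- frac 1 k) (ℚ.+-monoʳ-≤ 1ℚ (ℚ.neg-antimono-≤ 1/k≤1/[k-1])) ⟩
  (1ℚ - frac 1 k) - frac 1 k        ≤⟨ Pr≥1-2/k k C αstart αend sat-start sat-end ⟩
  Pr k C αstart αend                ∎
  where
  open ℚ.≤-Reasoning
  1/k≤1/[k-1] : frac 1 k ≤ℚ frac 1 (k ∸ 1)
  1/k≤1/[k-1] = frac-≤ 1 k 1 (k ∸ 1) (ℕ.*-monoʳ-≤ 1 (ℕ.m∸n≤m k 1))
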